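{- For every integer $n \geq 2$, $$\left\lceil \frac{3n-1}{4} \right\rceil - 1 \;\leq\; \operatorname{adim}(P_2 \square P_n) \;\leq\; \left\lceil \frac{3n-1}{4} \right\rceil.$$
   Context: All graphs are finite, simple and undirected. $P_n$ denotes the path graph on $n$ vertices and $G_1 \square G_2$ the Cartesian product: vertex set $V(G_1)\times V(G_2)$, with $(u,u')$ adjacent to $(v,v')$ iff either $u=v$ and $u'v' \in E(G_2)$, or $u'=v'$ and $uv\in E(G_1)$. For vertices $u,v$, $d(u,v)$ is the length of a shortest path between them ($\infty$ if none), and $d_1(u,v) := \min(d(u,v),2)$. A set $A \subseteq V(G)$ is an adjacency resolving set of $G$ if for any distinct $x,y \in V(G)$ there is $z \in A$ with $d_1(z,x) \neq d_1(z,y)$. The adjacency dimension $\operatorname{adim}(G)$ is the minimum cardinality of an adjacency resolving set of $G$. -}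

module Defs where

open import Data.Nat using (ℕ; zero; suc; _+_; _*_; _∸_; _≤_; NonZero)
open import Data.Nat.DivMod using (_/_)
open import Data.Fin using (Fin; toℕ)
open import Data.Fin.Properties renaming (_≟_ to _≟ᶠ_)
open import Data.Product using (_×_; _,_; Σ; ∃-syntax)
open import Data.Product.Properties using (≡-dec)
open import Data.Sum using (_⊎_; inj₁; inj₂)
open import Data.List using (List; length)
open import Data.List.Membership.Propositional using (_∈_)
open import Data.List.Relation.Unary.Unique.Propositional using (Unique)
open import Relation.Nullary using (¬_; Dec; yes; no)
open import Relation.Binary.PropositionalEquality using (_≡_; _≢_)
import Data.Nat.Properties as ℕP
open import Data.Sum.Properties using ()
open import Relation.Nullary.Decidable using (_⊎-dec_; _×-dec_)

record Graph : Set₁ where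
  field
    V     : Set
    _≟_   : (x y : V) → Dec (x ≡ y)
    Adj   : V → V → Set
    adj?  : (x y : V) → Dec (Adj x y)
    sym   : ∀ {x y} → Adj x y → Adj y x
    irrefl : ∀ {x} → ¬ Adj x x

open Graph public

-- d₁(u,v) = min(d(u,v), 2): it is 0 iff u = v, 1 iff u,v are adjacent,
-- and 2 otherwise (distance ≥ 2 or ∞).
d₁ : (G : Graph) → V G → V G → ℕ
d₁ G u v with _≟_ G u v
... | yes _ = 0
... | no _ with adj? G u v
...   | yes _ = 1
...   | no _  = 2

-- A (finite) vertex set is represented by a duplicate-free list;
-- its cardinality is its length.
IsAdjResolving : (G : Graph) → List (V G) → Set
IsAdjResolving G A =
  (x y : V G) → x ≢ y → ∃[ z ] (z ∈ A × d₁ G z x ≢ d₁ G z y)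

PathAdj : (n : ℕ) → Fin n → Fin n → Set
PathAdj n i j = (toℕ j ≡ suc (toℕ i)) ⊎ (toℕ i ≡ suc (toℕ j))

pathAdj? : (n : ℕ) → (i j : Fin n) → Dec (PathAdj n i j)
pathAdj? n i j = (toℕ j ℕP.≟ suc (toℕ i)) ⊎-dec (toℕ i ℕP.≟ suc (toℕ j))

pathSym : (n : ℕ) → ∀ {i j} → PathAdj n i j → PathAdj n j i
pathSym n (inj₁ p) = inj₂ p
pathSym n (inj₂ p) = inj₁ p

pathIrrefl : (n : ℕ) → ∀ {i} → ¬ PathAdj n i i
pathIrrefl n {i} (inj₁ p) = ℕP.1+n≢n (Relation.Binary.PropositionalEquality.sym p)
pathIrrefl n {i} (inj₂ p) = ℕP.1+n≢n (Relation.Binary.PropositionalEquality.sym p)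

P : ℕ → Graph
P n = record
  { V = Fin n ; _≟_ = _≟ᶠ_ ; Adj = PathAdj n ; adj? = pathAdj? n
  ; sym = pathSym n ; irrefl = pathIrrefl n }

BoxAdj : (G₁ G₂ : Graph) → V G₁ × V G₂ → V G₁ × V G₂ → Set
BoxAdj G₁ G₂ (u , u′) (v , v′) =
  (u ≡ v × Adj G₂ u′ v′) ⊎ (u′ ≡ v′ × Adj G₁ u v)

boxAdj? : (G₁ G₂ : Graph) → (x y : V G₁ × V G₂) → Dec (BoxAdj G₁ G₂ x y)
boxAdj? G₁ G₂ (u , u′) (v , v′) =
  ((_≟_ G₁ u v) ×-dec (adj? G₂ u′ v′)) ⊎-dec ((_≟_ G₂ u′ v′) ×-dec (adj? G₁ u v))

boxSym : (G₁ G₂ : Graph) → ∀ {x y} → BoxAdj G₁ G₂ x y → BoxAdj G₁ G₂ y x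
boxSym G₁ G₂ (inj₁ (Relation.Binary.PropositionalEquality.refl , a)) =
  inj₁ (Relation.Binary.PropositionalEquality.refl , sym G₂ a)
boxSym G₁ G₂ (inj₂ (Relation.Binary.PropositionalEquality.refl , a)) =
  inj₂ (Relation.Binary.PropositionalEquality.refl , sym G₁ a)

boxIrrefl : (G₁ G₂ : Graph) → ∀ {x} → ¬ BoxAdj G₁ G₂ x x
boxIrrefl G₁ G₂ (inj₁ (_ , a)) = irrefl G₂ a
boxIrrefl G₁ G₂ (inj₂ (_ , a)) = irrefl G₁ a

_□_ : Graph → Graph → Graph
G₁ □ G₂ = record
  { V = V G₁ × V G₂ ; _≟_ = ≡-dec (_≟_ G₁) (_≟_ G₂)
  ; Adj = BoxAdj G₁ G₂ ; adj? = boxAdj? G₁ G₂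
  ; sym = boxSym G₁ G₂ ; irrefl = boxIrrefl G₁ G₂ }

IsAdim : (G : Graph) → ℕ → Set
IsAdim G k =
  (Σ (List (V G)) λ A → Unique A × IsAdjResolving G A × length A ≡ k)
  × ((A : List (V G)) → Unique A → IsAdjResolving G A → k ≤ length A)

⌈_/_⌉ : ℕ → (d : ℕ) → .{{NonZero d}} → ℕ
⌈ m / d ⌉ = (m + (d ∸ 1)) / d

module Submission where

-- A vertex set A of the ladder P₂ □ Pₙ is read column by column as a word over four letters,
-- recording which of the two vertices of each column lie in A.  Since d₁ only tells apart the
-- distances 0, 1 and ≥ 2, A is resolving iff every window of five consecutive columns is valid:
-- the pairs at distance at most 2 are resolved inside the window, and along the whole word at
-- most one vertex is undominated (a pair farther apart has no common dominator, so it can only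
-- be unresolved when neither vertex is dominated).  A finite automaton, whose state is the last
-- four columns together with a flag recording an undominated vertex, recognises valid words.
-- Lower bound: an explicit potential Φ on the states, certified by computation, satisfies
-- Φ s′ ≥ Φ s + 3 − 4 k along every valid step reading a column with k vertices of A, and rises
-- by at most 1 over a whole run; hence 3 n ≤ 4 |A| + 1.
-- Upper bound: a periodic block with 6 vertices per 8 columns brings the automaton back to the
-- same state, which yields accepted words with 4 |A| ≤ 3 n + 2.

open import Defs hiding (sym; _≟_)

open import Data.Bool using (Bool; true; false; T; not; _∧_; _∨_)
open import Data.Bool.ListAction using (any; all)
open import Data.Bool.Properties using (T-≡; T-∧; T-∨; T?; ∧-zeroʳ)
open import Data.Empty using (⊥; ⊥-elim)
open import Data.Fin using (Fin; toℕ; fromℕ<) renaming (zero to fzero; suc to fsuc)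
open import Data.Fin.Properties using (toℕ-injective; toℕ<n; toℕ-fromℕ<)
open import Data.List using (List; []; _∷_; _++_; map; length; replicate; upTo; cartesianProduct; deduplicate)
open import Data.List.Membership.Propositional using (_∈_; find; lose)
open import Data.List.Membership.Propositional.Properties
  using (∈-upTo⁺; ∈-cartesianProduct⁺; ∈-++⁺ˡ; ∈-++⁺ʳ; ∈-++⁻; ∈-map⁺; ∈-map⁻; ∈-deduplicate⁺)
open import Data.List.Properties using (length-replicate; length-++; length-map; map-++; ++-assoc; length-deduplicate)
open import Data.List.Relation.Unary.All using (All; _∷_; [])
import Data.List.Relation.Unary.All as All
open import Data.List.Relation.Unary.All.Properties using (all⁺; all⁻)
open import Data.List.Relation.Unary.Any using (here; there)
open import Data.List.Relation.Unary.Any.Properties using (any⁺; any⁻)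
open import Data.List.Relation.Unary.Unique.DecPropositional.Properties using (deduplicate-!)
open import Data.Maybe using (Maybe; just; nothing; is-just)
open import Data.Nat using (ℕ; zero; suc; _+_; _*_; _∸_; _≤_; _<_; _≥_; _≡ᵇ_; _<ᵇ_; _≤ᵇ_; z≤n; s≤s; z<s; s<s)
open import Data.Nat.DivMod using (_/_; _%_; m≡m%n+[m/n]*n; m%n<n; m<n*o⇒m/o<n; /-monoˡ-≤; m*n/n≡m)
open import Data.Nat.ListAction using (sum)
open import Data.Nat.ListAction.Properties using (sum-++)
open import Data.Nat.Properties
open import Data.Nat.Tactic.RingSolver using (solve-∀)
open import Data.Product using (Σ; _×_; _,_; proj₁; proj₂; ∃; ∃₂; map₂)
open import Data.Sum using (_⊎_; inj₁; inj₂; [_,_]′)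
open import Data.Unit using (tt)
open import Function using (_∘_; case_of_)
open import Function.Bundles using (Equivalence; _⇔_; mk⇔)
open import Relation.Binary.PropositionalEquality
  using (_≡_; _≢_; refl; cong; cong₂; sym; trans; subst; subst₂; module ≡-Reasoning)
open import Relation.Nullary using (¬_; yes; no)

open Equivalence using (to; from)

d₁-≡ : ∀ (G : Graph) {u v} (t : ℕ) → (u ≡ v → t ≡ 0) → (u ≢ v → Adj G u v → t ≡ 1) →
       (u ≢ v → ¬ Adj G u v → t ≡ 2) → d₁ G u v ≡ t
d₁-≡ G {u} {v} t h₀ h₁ h₂ with Graph._≟_ G u v
... | yes u≡v = sym (h₀ u≡v)
... | no u≢v with adj? G u v
...   | yes uv = sym (h₁ u≢v uv)
...   | no ¬uv = sym (h₂ u≢v ¬uv)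

isAdim : ∀ (G : Graph) k (A : List (V G)) → IsAdjResolving G A → length A ≤ k →
         (∀ B → IsAdjResolving G B → k ≤ length B) → IsAdim G k
isAdim G k A res |A|≤k minimal =
  (A′ , deduplicate-! (Graph._≟_ G) A , res′ ,
   ≤-antisym (≤-trans (length-deduplicate (Graph._≟_ G) A) |A|≤k) (minimal A′ res′)) ,
  λ B _ resB → minimal B resB
  where
  A′ : List (V G)
  A′ = deduplicate (Graph._≟_ G) A
  res′ : IsAdjResolving G A′
  res′ x y x≢y = let z , z∈A , d≢ = res x y x≢y in z , ∈-deduplicate⁺ (Graph._≟_ G) z∈A , d≢

T-not⁻ : ∀ {b} → T (not b) → ¬ T b
T-not⁻ {false} _ ()

T-not⁺ : ∀ {b} → ¬ T b → T (not b)
T-not⁺ {false} _  = tt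
T-not⁺ {true}  ¬b = ¬b tt

T-not-∧⁺ : ∀ {a b} → (T a → T b → ⊥) → T (not (a ∧ b))
T-not-∧⁺ {a} {b} h = T-not⁺ (λ ab → let (ta , tb) = to (T-∧ {a} {b}) ab in h ta tb)

T-→⁺ : ∀ {a b c} → (T a → T b → T c) → T (not (a ∧ b) ∨ c)
T-→⁺ {false}         h = tt
T-→⁺ {true} {false}  h = tt
T-→⁺ {true} {true}   h = h tt tt

T-→⁻ : ∀ {a b c} → T (not (a ∧ b) ∨ c) → T a → T b → T c
T-→⁻ {true} {true} h _ _ = h

≡ᵇ-refl : ∀ m → (m ≡ᵇ m) ≡ true
≡ᵇ-refl m = to T-≡ (≡⇒≡ᵇ m m refl)

-- Distances in the ladder

Ladder : ℕ → Graph
Ladder n = P 2 □ P n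

Vertex : ℕ → Set
Vertex n = Fin 2 × Fin n

row : ∀ {n} → Vertex n → ℕ
row (r , _) = toℕ r

col : ∀ {n} → Vertex n → ℕ
col (_ , i) = toℕ i

data Gap : Set where
  same next far : Gap

gap : ℕ → ℕ → Gap
gap zero          zero          = same
gap zero          (suc zero)    = next
gap zero          (suc (suc _)) = far
gap (suc i)       (suc j)       = gap i j
gap (suc zero)    zero          = next
gap (suc (suc _)) zero          = far

cappedDistance : Bool → Gap → ℕ
cappedDistance true  same = 0
cappedDistance true  next = 1
cappedDistance true  far  = 2
cappedDistance false same = 1
cappedDistance false next = 2
cappedDistance false far  = 2

-- Arguments: row and column of the first vertex, then of the second.
ladderD₁ : ℕ → ℕ → ℕ → ℕ → ℕ
ladderD₁ r i s j = cappedDistance (r ≡ᵇ s) (gap i j)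

gap-refl : ∀ i → gap i i ≡ same
gap-refl zero    = refl
gap-refl (suc i) = gap-refl i

gap-sucʳ : ∀ i → gap i (suc i) ≡ next
gap-sucʳ zero    = refl
gap-sucʳ (suc i) = gap-sucʳ i

gap-sucˡ : ∀ i → gap (suc i) i ≡ next
gap-sucˡ zero    = refl
gap-sucˡ (suc i) = gap-sucˡ i

gap-same⁻ : ∀ i j → gap i j ≡ same → i ≡ j
gap-same⁻ zero          zero          _ = refl
gap-same⁻ (suc i)       (suc j)       e = cong suc (gap-same⁻ i j e)
gap-same⁻ zero          (suc zero)    ()
gap-same⁻ zero          (suc (suc _)) ()
gap-same⁻ (suc zero)    zero          ()
gap-same⁻ (suc (suc _)) zero          ()

gap-next⁻ : ∀ i j → gap i j ≡ next → j ≡ suc i ⊎ i ≡ suc j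
gap-next⁻ zero       (suc zero) _ = inj₁ refl
gap-next⁻ (suc zero) zero       _ = inj₂ refl
gap-next⁻ (suc i)    (suc j)    e with gap-next⁻ i j e
... | inj₁ j≡1+i = inj₁ (cong suc j≡1+i)
... | inj₂ i≡1+j = inj₂ (cong suc i≡1+j)
gap-next⁻ zero          zero          ()
gap-next⁻ zero          (suc (suc _)) ()
gap-next⁻ (suc (suc _)) zero          ()

gap-+ : ∀ k i j → gap (k + i) (k + j) ≡ gap i j
gap-+ zero    i j = refl
gap-+ (suc k) i j = gap-+ k i j

rowCases : (r s : Fin 2) →
           ((toℕ r ≡ᵇ toℕ s) ≡ true × r ≡ s) ⊎ ((toℕ r ≡ᵇ toℕ s) ≡ false × PathAdj 2 r s)
rowCases fzero        fzero        = inj₁ (refl , refl)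
rowCases fzero        (fsuc fzero) = inj₂ (refl , inj₁ refl)
rowCases (fsuc fzero) fzero        = inj₂ (refl , inj₂ refl)
rowCases (fsuc fzero) (fsuc fzero) = inj₁ (refl , refl)

ladder-d₁ : ∀ {n} (u v : Vertex n) → d₁ (Ladder n) u v ≡ ladderD₁ (row u) (col u) (row v) (col v)
ladder-d₁ {n} (r , i) (s , j) = d₁-≡ (Ladder n) _ equal adjacent distant
  where
  equal : (r , i) ≡ (s , j) → ladderD₁ (toℕ r) (toℕ i) (toℕ s) (toℕ j) ≡ 0
  equal refl rewrite ≡ᵇ-refl (toℕ r) | gap-refl (toℕ i) = refl
  adjacent : (r , i) ≢ (s , j) → BoxAdj (P 2) (P n) (r , i) (s , j) →
             ladderD₁ (toℕ r) (toℕ i) (toℕ s) (toℕ j) ≡ 1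
  adjacent _ (inj₁ (refl , inj₁ j≡1+i)) rewrite ≡ᵇ-refl (toℕ r) | j≡1+i | gap-sucʳ (toℕ i) = refl
  adjacent _ (inj₁ (refl , inj₂ i≡1+j)) rewrite ≡ᵇ-refl (toℕ r) | i≡1+j | gap-sucˡ (toℕ j) = refl
  adjacent _ (inj₂ (refl , rs)) with rowCases r s
  ... | inj₁ (_ , refl)  = ⊥-elim (pathIrrefl 2 rs)
  ... | inj₂ (r≢ᵇs , _) rewrite r≢ᵇs | gap-refl (toℕ i) = refl
  distant : (r , i) ≢ (s , j) → ¬ BoxAdj (P 2) (P n) (r , i) (s , j) →
            ladderD₁ (toℕ r) (toℕ i) (toℕ s) (toℕ j) ≡ 2
  distant u≢v ¬uv with rowCases r s | gap (toℕ i) (toℕ j) in ij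
  ... | inj₁ (_ , refl)   | same = ⊥-elim (u≢v (cong (r ,_) (toℕ-injective (gap-same⁻ _ _ ij))))
  ... | inj₁ (_ , refl)   | next = ⊥-elim (¬uv (inj₁ (refl , gap-next⁻ _ _ ij)))
  ... | inj₁ (r≡ᵇs , refl) | far rewrite r≡ᵇs = refl
  ... | inj₂ (_ , rs)     | same = ⊥-elim (¬uv (inj₂ (toℕ-injective (gap-same⁻ _ _ ij) , rs)))
  ... | inj₂ (r≢ᵇs , _)   | next rewrite r≢ᵇs = refl
  ... | inj₂ (r≢ᵇs , _)   | far  rewrite r≢ᵇs = refl

ladderD₁-+ : ∀ k r i s j → ladderD₁ r (k + i) s (k + j) ≡ ladderD₁ r i s j
ladderD₁-+ k r i s j = cong (cappedDistance (r ≡ᵇ s)) (gap-+ k i j)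

ladderD₁≤2 : ∀ r i s j → ladderD₁ r i s j ≤ 2
ladderD₁≤2 r i s j with r ≡ᵇ s | gap i j
... | true  | same = z≤n
... | true  | next = s≤s z≤n
... | true  | far  = ≤-refl
... | false | same = s≤s z≤n
... | false | next = ≤-refl
... | false | far  = ≤-refl

d₁≤2 : ∀ {n} (z x : Vertex n) → d₁ (Ladder n) z x ≤ 2
d₁≤2 z x = subst (_≤ 2) (sym (ladder-d₁ z x)) (ladderD₁≤2 (row z) (col z) (row x) (col x))

ladderD₁<2⁻ : ∀ r i s j → ladderD₁ r i s j < 2 → i ≡ j ⊎ (r ≡ s × (j ≡ suc i ⊎ i ≡ suc j))
ladderD₁<2⁻ r i s j d<2 with r ≡ᵇ s in rs | gap i j in ij
... | _     | same = inj₁ (gap-same⁻ i j ij)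
... | true  | next = inj₂ (≡ᵇ⇒≡ r s (from T-≡ rs) , gap-next⁻ i j ij)
... | true  | far  = ⊥-elim (<-irrefl refl d<2)
... | false | next = ⊥-elim (<-irrefl refl d<2)
... | false | far  = ⊥-elim (<-irrefl refl d<2)

ladderD₁<2⇒near : ∀ r i s j → ladderD₁ r i s j < 2 → i ≤ suc j × j ≤ suc i
ladderD₁<2⇒near r i s j d<2 with ladderD₁<2⁻ r i s j d<2
... | inj₁ refl               = n≤1+n i , n≤1+n i
... | inj₂ (_ , inj₁ refl)    = m≤n⇒m≤1+n (n≤1+n i) , ≤-refl
... | inj₂ (_ , inj₂ refl)    = ≤-refl , m≤n⇒m≤1+n (n≤1+n j)

Far : ℕ → ℕ → ℕ → Set
Far r s d = 3 ≤ d ⊎ (d ≡ 2 × r ≢ s)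

Far⇒2≤gap : ∀ {r s d} → Far r s d → 2 ≤ d
Far⇒2≤gap (inj₁ 3≤d)      = ≤-trans (n≤1+n 2) 3≤d
Far⇒2≤gap (inj₂ (refl , _)) = ≤-refl

n+2≰1+n : ∀ n → ¬ n + 2 ≤ suc n
n+2≰1+n n h = 1+n≰n (subst (_≤ suc n) (+-comm n 2) h)

far-no-common-neighbour : ∀ rz k r i s d → Far r s d →
                          ladderD₁ rz k r i < 2 → ladderD₁ rz k s (i + d) < 2 → ⊥
far-no-common-neighbour rz k r i s d farness near-x near-y
  with ladderD₁<2⇒near rz k r i near-x | ladderD₁<2⇒near rz k s (i + d) near-y | farness
... | k≤1+i , _ | _ , i+d≤1+k | inj₁ 3≤d = 1+n≰n (begin
  3 + i   ≡⟨ +-comm 3 i ⟩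
  i + 3   ≤⟨ +-monoʳ-≤ i 3≤d ⟩
  i + d   ≤⟨ i+d≤1+k ⟩
  suc k   ≤⟨ s≤s k≤1+i ⟩
  2 + i   ∎)
  where open ≤-Reasoning
... | k≤1+i , _ | _ , i+2≤1+k | inj₂ (refl , r≢s)
  with ladderD₁<2⁻ rz k r i near-x | ladderD₁<2⁻ rz k s (i + 2) near-y
...   | inj₂ (rz≡r , _) | inj₂ (rz≡s , _) = r≢s (trans (sym rz≡r) rz≡s)
...   | inj₁ refl       | _               = n+2≰1+n i i+2≤1+k
...   | inj₂ _          | inj₁ refl       = n+2≰1+n i k≤1+i

far-no-common-dominator : ∀ {n} (x y z : Vertex n) {d} → col y ≡ col x + d → Far (row x) (row y) d →
                          d₁ (Ladder n) z x < 2 → d₁ (Ladder n) z y < 2 → ⊥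
far-no-common-dominator x y z {d} e farness zx<2 zy<2 =
  far-no-common-neighbour (row z) (col z) (row x) (col x) (row y) d farness
    (subst (_< 2) (ladder-d₁ z x) zx<2)
    (subst (_< 2) (trans (ladder-d₁ z y) (cong (ladderD₁ (row z) (col z) (row y)) e)) zy<2)

-- Windows

-- The vertices of one ladder column that lie in A, as (row 0 , row 1); cells beyond the ends
-- of the ladder are `nothing`.
Column : Set
Column = Bool × Bool

pattern none   = false , false
pattern top    = true  , false
pattern bottom = false , true
pattern both   = true  , true

occupies : ℕ → Maybe Column → Bool
occupies 0 (just (t , _)) = t
occupies 1 (just (_ , b)) = b
occupies _ _              = false

size : Column → ℕ
size none   = 0
size top    = 1
size bottom = 1
size both   = 2

Cells : Set
Cells = ℕ → Maybe Column

windowPositions : List (ℕ × ℕ)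
windowPositions = cartesianProduct (upTo 2) (upTo 5)

occupiedWith : Cells → (ℕ → ℕ → Bool) → ℕ × ℕ → Bool
occupiedWith f p (r , o) = occupies r (f o) ∧ p r o

anyOccupied : Cells → (ℕ → ℕ → Bool) → Bool
anyOccupied f p = any (occupiedWith f p) windowPositions

anyOccupied⁺ : ∀ f p {r o} → r < 2 → o < 5 → T (occupies r (f o)) → T (p r o) → T (anyOccupied f p)
anyOccupied⁺ f p r<2 o<5 occ pro =
  any⁺ (occupiedWith f p) (lose (∈-cartesianProduct⁺ (∈-upTo⁺ r<2) (∈-upTo⁺ o<5)) (from T-∧ (occ , pro)))

anyOccupied⁻ : ∀ f p → T (anyOccupied f p) → ∃₂ λ r o → T (occupies r (f o)) × T (p r o)
anyOccupied⁻ f p h with find (any⁻ (occupiedWith f p) windowPositions h)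
... | (r , o) , _ , occ∧pro = r , o , to T-∧ occ∧pro

dominated : Cells → ℕ → ℕ → Bool
dominated f r o = anyOccupied f (λ r′ o′ → ladderD₁ r′ o′ r o <ᵇ 2)

resolves : Cells → ℕ → ℕ → ℕ → ℕ → Bool
resolves f rx ox ry oy = anyOccupied f (λ r o → not (ladderD₁ r o rx ox ≡ᵇ ladderD₁ r o ry oy))

resolvedIfPresent : Cells → ℕ → ℕ → ℕ → ℕ → Bool
resolvedIfPresent f rx ox ry oy = not (is-just (f ox) ∧ is-just (f oy)) ∨ resolves f rx ox ry oy

-- (row x , row y , column gap) for the pairs {x , y} at distance at most 2, x leftmost.  When x
-- sits at offset 1 of a window, every vertex within distance 1 of x or y lies in the window.
closePairs : List (ℕ × ℕ × ℕ)
closePairs = (0 , 1 , 0) ∷ (0 , 0 , 1) ∷ (1 , 1 , 1) ∷ (0 , 1 , 1) ∷ (1 , 0 , 1) ∷ (0 , 0 , 2) ∷ (1 , 1 , 2) ∷ []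

ClosePair : ℕ × ℕ × ℕ → Set
ClosePair (rx , ry , d) = rx < 2 × ry < 2 × d ≤ 2 × (rx ≢ ry ⊎ 0 < d)

closePairs-close : All ClosePair closePairs
closePairs-close =
  (s≤s z≤n , ≤-refl , z≤n , inj₁ (λ ())) ∷ (s≤s z≤n , s≤s z≤n , s≤s z≤n , inj₂ z<s) ∷
  (≤-refl , ≤-refl , s≤s z≤n , inj₂ z<s) ∷ (s≤s z≤n , ≤-refl , s≤s z≤n , inj₂ z<s) ∷
  (≤-refl , s≤s z≤n , s≤s z≤n , inj₂ z<s) ∷ (s≤s z≤n , s≤s z≤n , ≤-refl , inj₂ z<s) ∷
  (≤-refl , ≤-refl , ≤-refl , inj₂ z<s) ∷ []

closePairResolved : Cells → ℕ × ℕ × ℕ → Bool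
closePairResolved f (rx , ry , d) = resolvedIfPresent f rx 1 ry (1 + d)

closePairsResolved : Cells → Bool
closePairsResolved f = all (closePairResolved f) closePairs

undominated : Cells → ℕ → Bool
undominated f r = is-just (f 2) ∧ not (dominated f r 2)

someUndominated : Cells → Bool
someUndominated f = undominated f 0 ∨ undominated f 1

-- A window f is five consecutive cells; e records an undominated vertex to its left.
valid : Cells → Bool → Bool
valid f e = closePairsResolved f ∧ not (undominated f 0 ∧ undominated f 1) ∧ not (e ∧ someUndominated f)

valid⁺ : ∀ f e → T (closePairsResolved f) → T (not (undominated f 0 ∧ undominated f 1)) →
         T (not (e ∧ someUndominated f)) → T (valid f e)
valid⁺ f e a b c = from T-∧ (a , from T-∧ (b , c))

valid⁻ : ∀ f e → T (valid f e) →
         T (closePairsResolved f) × T (not (undominated f 0 ∧ undominated f 1)) × T (not (e ∧ someUndominated f))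
valid⁻ f e h = let a , bc = to (T-∧ {closePairsResolved f}) h
                   b , c  = to (T-∧ {not (undominated f 0 ∧ undominated f 1)}) bc
               in a , b , c

nextFlag : Cells → Bool → Bool
nextFlag f e = e ∨ someUndominated f

shift : ℕ → Cells → Cells
shift k g o = g (k + o)

flag : Cells → Bool → ℕ → Bool
flag g e zero    = e
flag g e (suc k) = flag (shift 1 g) (nextFlag g e) k

flag-true : ∀ g k → T (flag g true k)
flag-true g zero    = tt
flag-true g (suc k) = flag-true (shift 1 g) k

flag-set : ∀ g e {j k} → j < k → T (someUndominated (shift j g)) → T (flag g e k)
flag-set g e {zero}  {suc k} _         u =
  subst (λ b → T (flag (shift 1 g) b k)) (sym (to T-≡ (from (T-∨ {e}) (inj₂ u)))) (flag-true (shift 1 g) k)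
flag-set g e {suc j} {suc k} (s<s j<k) u = flag-set (shift 1 g) (nextFlag g e) j<k u

flag-source : ∀ g e k → T (flag g e k) → T e ⊎ ∃ λ j → j < k × T (someUndominated (shift j g))
flag-source g e zero    h = inj₁ h
flag-source g e (suc k) h with flag-source (shift 1 g) (nextFlag g e) k h
... | inj₂ (j , j<k , u) = inj₂ (suc j , s<s j<k , u)
... | inj₁ e∨u with to (T-∨ {e}) e∨u
...   | inj₁ te = inj₁ te
...   | inj₂ u  = inj₂ (0 , z<s , u)

WindowsValid : Cells → Bool → Set
WindowsValid g e = ∀ k → T (valid (shift k g) (flag g e k))

-- The scanning automaton

cellAt : List (Maybe Column) → Cells
cellAt []      _       = nothing
cellAt (c ∷ l) zero    = c
cellAt (c ∷ l) (suc o) = cellAt l o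

valid-empty : ∀ f e → (∀ o → f o ≡ nothing) → T (valid f e)
valid-empty f e empty = subst T (sym (cong (λ cs → valid (cellAt cs) e) window≡)) (empty-window e)
  where
  window≡ : f 0 ∷ f 1 ∷ f 2 ∷ f 3 ∷ f 4 ∷ [] ≡ replicate 5 nothing
  window≡ = cong₂ _∷_ (empty 0) (cong₂ _∷_ (empty 1) (cong₂ _∷_ (empty 2)
              (cong₂ _∷_ (empty 3) (cong₂ _∷_ (empty 4) refl))))
  empty-window : ∀ e → T (valid (cellAt (replicate 5 nothing)) e)
  empty-window false = tt
  empty-window true  = tt

State : Set
State = Maybe Column × Maybe Column × Maybe Column × Maybe Column × Bool

cellsFrom : State → List (Maybe Column) → Cells
cellsFrom (c₀ , c₁ , c₂ , c₃ , _) l = cellAt (c₀ ∷ c₁ ∷ c₂ ∷ c₃ ∷ l)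

flagOf : State → Bool
flagOf (_ , _ , _ , _ , e) = e

window : State → Maybe Column → Cells
window s c = cellsFrom s (c ∷ [])

step : State → Maybe Column → State
step s@(_ , c₁ , c₂ , c₃ , e) c = c₁ , c₂ , c₃ , c , nextFlag (window s c) e

run : State → List (Maybe Column) → State
run s []      = s
run s (c ∷ l) = run (step s c) l

validStep : State → Maybe Column → Bool
validStep s c = valid (window s c) (flagOf s)

windowsValid-head : ∀ s c l → WindowsValid (cellsFrom s (c ∷ l)) (flagOf s) → T (validStep s c)
windowsValid-head (_ , _ , _ , _ , _) c l h = h 0

windowsValid-tail : ∀ s c l → WindowsValid (cellsFrom s (c ∷ l)) (flagOf s) →
                    WindowsValid (cellsFrom (step s c) l) (flagOf (step s c))
windowsValid-tail (_ , _ , _ , _ , _) c l h k = h (suc k)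

final : State → Bool
final (c₀ , c₁ , c₂ , c₃ , _) = not (is-just c₀ ∨ is-just c₁ ∨ is-just c₂ ∨ is-just c₃)

validRun : State → List (Maybe Column) → Bool
validRun s []      = true
validRun s (c ∷ l) = validStep s c ∧ validRun (step s c) l

accepts : State → List (Maybe Column) → Bool
accepts s []      = final s
accepts s (c ∷ l) = validStep s c ∧ accepts (step s c) l

accepts-++ : ∀ s xs ys → T (validRun s xs) → T (accepts (run s xs) ys) → T (accepts s (xs ++ ys))
accepts-++ s []       ys _ h = h
accepts-++ s (c ∷ xs) ys v h =
  let vc , vxs = to (T-∧ {validStep s c}) v in from T-∧ (vc , accepts-++ (step s c) xs ys vxs h)

final-cells : ∀ s → T (final s) → ∀ p → cellsFrom s [] p ≡ nothing
final-cells (nothing , nothing , nothing , nothing , _) _ 0                         = refl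
final-cells (nothing , nothing , nothing , nothing , _) _ 1                         = refl
final-cells (nothing , nothing , nothing , nothing , _) _ 2                         = refl
final-cells (nothing , nothing , nothing , nothing , _) _ 3                         = refl
final-cells (nothing , nothing , nothing , nothing , _) _ (suc (suc (suc (suc _)))) = refl
final-cells (just _  , _       , _       , _       , _) ()
final-cells (nothing , just _  , _       , _       , _) ()
final-cells (nothing , nothing , just _  , _       , _) ()
final-cells (nothing , nothing , nothing , just _  , _) ()

accepts-sound : ∀ s l → T (accepts s l) → WindowsValid (cellsFrom s l) (flagOf s)
accepts-sound s@(_ , _ , _ , _ , _) [] h k = valid-empty _ _ (λ o → final-cells s h (k + o))
accepts-sound s@(_ , _ , _ , _ , _) (c ∷ l) h zero    = proj₁ (to (T-∧ {validStep s c}) h)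
accepts-sound s@(_ , _ , _ , _ , _) (c ∷ l) h (suc k) =
  accepts-sound (step s c) l (proj₂ (to (T-∧ {validStep s c}) h)) k

initial : State
initial = nothing , nothing , nothing , nothing , false

pads : List (Maybe Column)
pads = replicate 4 nothing

padded : List Column → Cells
padded w = cellsFrom initial (map just w ++ pads)

-- A potential for the automaton

width : Maybe Column → ℕ
width nothing  = 0
width (just _) = 1

cellSize : Maybe Column → ℕ
cellSize nothing  = 0
cellSize (just c) = size c

cellIndex : Maybe Column → ℕ
cellIndex nothing       = 0
cellIndex (just none)   = 1
cellIndex (just top)    = 2
cellIndex (just bottom) = 3
cellIndex (just both)   = 4

flagIndex : Bool → ℕ
flagIndex false = 0
flagIndex true  = 1

-- A solution of the difference constraints of `potential-step`, found by a longest-path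
-- computation on the automaton.  Row c₀ c₁ lists the values at (c₂ , c₃ , e) in lexicographic
-- order, cells ordered nothing , none , top , bottom , both and flags false , true.
potentialRow : Maybe Column → Maybe Column → List ℕ
potentialRow nothing       nothing       = 3 ∷ 4 ∷ 6 ∷ 7 ∷ 2 ∷ 3 ∷ 2 ∷ 3 ∷ 0 ∷ 0 ∷ 6 ∷ 7 ∷ 9 ∷ 10 ∷ 5 ∷ 6 ∷ 5 ∷ 6 ∷ 1 ∷ 2 ∷ 2 ∷ 3 ∷ 5 ∷ 6 ∷ 1 ∷ 2 ∷ 1 ∷ 2 ∷ 0 ∷ 0 ∷ 2 ∷ 3 ∷ 5 ∷ 6 ∷ 1 ∷ 2 ∷ 1 ∷ 2 ∷ 0 ∷ 0 ∷ 0 ∷ 0 ∷ 3 ∷ 3 ∷ 0 ∷ 0 ∷ 0 ∷ 0 ∷ 0 ∷ 0 ∷ []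
potentialRow nothing       (just none)   = 0 ∷ 0 ∷ 0 ∷ 0 ∷ 0 ∷ 0 ∷ 0 ∷ 0 ∷ 0 ∷ 0 ∷ 0 ∷ 0 ∷ 0 ∷ 0 ∷ 0 ∷ 0 ∷ 0 ∷ 0 ∷ 0 ∷ 0 ∷ 0 ∷ 5 ∷ 0 ∷ 8 ∷ 0 ∷ 4 ∷ 0 ∷ 4 ∷ 0 ∷ 0 ∷ 0 ∷ 5 ∷ 0 ∷ 8 ∷ 0 ∷ 4 ∷ 0 ∷ 4 ∷ 0 ∷ 0 ∷ 1 ∷ 2 ∷ 4 ∷ 5 ∷ 0 ∷ 1 ∷ 0 ∷ 1 ∷ 0 ∷ 0 ∷ []
potentialRow nothing       (just top)    = 2 ∷ 3 ∷ 5 ∷ 6 ∷ 1 ∷ 2 ∷ 1 ∷ 2 ∷ 0 ∷ 0 ∷ 5 ∷ 6 ∷ 8 ∷ 9 ∷ 4 ∷ 5 ∷ 4 ∷ 5 ∷ 0 ∷ 1 ∷ 1 ∷ 2 ∷ 4 ∷ 5 ∷ 0 ∷ 1 ∷ 0 ∷ 1 ∷ 0 ∷ 0 ∷ 1 ∷ 2 ∷ 4 ∷ 5 ∷ 0 ∷ 1 ∷ 0 ∷ 1 ∷ 0 ∷ 0 ∷ 0 ∷ 0 ∷ 3 ∷ 3 ∷ 0 ∷ 0 ∷ 0 ∷ 0 ∷ 0 ∷ 0 ∷ []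
potentialRow nothing       (just bottom) = 2 ∷ 3 ∷ 5 ∷ 6 ∷ 1 ∷ 2 ∷ 1 ∷ 2 ∷ 0 ∷ 0 ∷ 5 ∷ 6 ∷ 8 ∷ 9 ∷ 4 ∷ 5 ∷ 4 ∷ 5 ∷ 0 ∷ 1 ∷ 1 ∷ 2 ∷ 4 ∷ 5 ∷ 0 ∷ 1 ∷ 0 ∷ 1 ∷ 0 ∷ 0 ∷ 1 ∷ 2 ∷ 4 ∷ 5 ∷ 0 ∷ 1 ∷ 0 ∷ 1 ∷ 0 ∷ 0 ∷ 0 ∷ 0 ∷ 3 ∷ 3 ∷ 0 ∷ 0 ∷ 0 ∷ 0 ∷ 0 ∷ 0 ∷ []
potentialRow nothing       (just both)   = 0 ∷ 0 ∷ 3 ∷ 3 ∷ 0 ∷ 0 ∷ 0 ∷ 0 ∷ 0 ∷ 0 ∷ 3 ∷ 3 ∷ 6 ∷ 6 ∷ 2 ∷ 2 ∷ 2 ∷ 2 ∷ 0 ∷ 0 ∷ 0 ∷ 0 ∷ 3 ∷ 3 ∷ 0 ∷ 0 ∷ 0 ∷ 0 ∷ 0 ∷ 0 ∷ 0 ∷ 0 ∷ 3 ∷ 3 ∷ 0 ∷ 0 ∷ 0 ∷ 0 ∷ 0 ∷ 0 ∷ 0 ∷ 0 ∷ 3 ∷ 3 ∷ 0 ∷ 0 ∷ 0 ∷ 0 ∷ 0 ∷ 0 ∷ []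
potentialRow (just none)   nothing       = 3 ∷ 3 ∷ 6 ∷ 6 ∷ 2 ∷ 2 ∷ 2 ∷ 2 ∷ 0 ∷ 0 ∷ 6 ∷ 6 ∷ 9 ∷ 9 ∷ 5 ∷ 5 ∷ 5 ∷ 5 ∷ 1 ∷ 1 ∷ 2 ∷ 2 ∷ 5 ∷ 5 ∷ 1 ∷ 1 ∷ 1 ∷ 1 ∷ 0 ∷ 0 ∷ 2 ∷ 2 ∷ 5 ∷ 5 ∷ 1 ∷ 1 ∷ 1 ∷ 1 ∷ 0 ∷ 0 ∷ 0 ∷ 0 ∷ 3 ∷ 3 ∷ 0 ∷ 0 ∷ 0 ∷ 0 ∷ 0 ∷ 0 ∷ []
potentialRow (just none)   (just none)   = 0 ∷ 0 ∷ 0 ∷ 0 ∷ 0 ∷ 0 ∷ 0 ∷ 0 ∷ 0 ∷ 0 ∷ 0 ∷ 0 ∷ 0 ∷ 0 ∷ 0 ∷ 0 ∷ 0 ∷ 0 ∷ 0 ∷ 0 ∷ 0 ∷ 5 ∷ 0 ∷ 8 ∷ 0 ∷ 4 ∷ 0 ∷ 4 ∷ 0 ∷ 0 ∷ 0 ∷ 5 ∷ 0 ∷ 8 ∷ 0 ∷ 4 ∷ 0 ∷ 4 ∷ 0 ∷ 0 ∷ 1 ∷ 1 ∷ 4 ∷ 4 ∷ 0 ∷ 0 ∷ 0 ∷ 0 ∷ 0 ∷ 0 ∷ []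
potentialRow (just none)   (just top)    = 2 ∷ 4 ∷ 5 ∷ 7 ∷ 1 ∷ 3 ∷ 1 ∷ 3 ∷ 0 ∷ 0 ∷ 5 ∷ 7 ∷ 8 ∷ 10 ∷ 4 ∷ 6 ∷ 4 ∷ 6 ∷ 0 ∷ 2 ∷ 1 ∷ 3 ∷ 4 ∷ 6 ∷ 0 ∷ 2 ∷ 0 ∷ 2 ∷ 0 ∷ 0 ∷ 1 ∷ 4 ∷ 4 ∷ 7 ∷ 0 ∷ 3 ∷ 0 ∷ 3 ∷ 0 ∷ 0 ∷ 0 ∷ 0 ∷ 3 ∷ 3 ∷ 0 ∷ 0 ∷ 0 ∷ 0 ∷ 0 ∷ 0 ∷ []
potentialRow (just none)   (just bottom) = 2 ∷ 4 ∷ 5 ∷ 7 ∷ 1 ∷ 3 ∷ 1 ∷ 3 ∷ 0 ∷ 0 ∷ 5 ∷ 7 ∷ 8 ∷ 10 ∷ 4 ∷ 6 ∷ 4 ∷ 6 ∷ 0 ∷ 2 ∷ 1 ∷ 4 ∷ 4 ∷ 7 ∷ 0 ∷ 3 ∷ 0 ∷ 3 ∷ 0 ∷ 0 ∷ 1 ∷ 3 ∷ 4 ∷ 6 ∷ 0 ∷ 2 ∷ 0 ∷ 2 ∷ 0 ∷ 0 ∷ 0 ∷ 0 ∷ 3 ∷ 3 ∷ 0 ∷ 0 ∷ 0 ∷ 0 ∷ 0 ∷ 0 ∷ []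
potentialRow (just none)   (just both)   = 1 ∷ 2 ∷ 4 ∷ 5 ∷ 0 ∷ 1 ∷ 0 ∷ 1 ∷ 0 ∷ 0 ∷ 3 ∷ 3 ∷ 6 ∷ 6 ∷ 2 ∷ 4 ∷ 2 ∷ 4 ∷ 0 ∷ 0 ∷ 0 ∷ 1 ∷ 3 ∷ 4 ∷ 0 ∷ 0 ∷ 0 ∷ 0 ∷ 0 ∷ 0 ∷ 0 ∷ 1 ∷ 3 ∷ 4 ∷ 0 ∷ 0 ∷ 0 ∷ 0 ∷ 0 ∷ 0 ∷ 0 ∷ 0 ∷ 3 ∷ 3 ∷ 0 ∷ 0 ∷ 0 ∷ 0 ∷ 0 ∷ 0 ∷ []
potentialRow (just top)    nothing       = 2 ∷ 4 ∷ 5 ∷ 7 ∷ 1 ∷ 3 ∷ 1 ∷ 3 ∷ 0 ∷ 0 ∷ 5 ∷ 7 ∷ 8 ∷ 10 ∷ 4 ∷ 6 ∷ 4 ∷ 6 ∷ 0 ∷ 2 ∷ 1 ∷ 3 ∷ 4 ∷ 6 ∷ 0 ∷ 2 ∷ 0 ∷ 2 ∷ 0 ∷ 0 ∷ 1 ∷ 3 ∷ 4 ∷ 6 ∷ 0 ∷ 2 ∷ 0 ∷ 2 ∷ 0 ∷ 0 ∷ 0 ∷ 0 ∷ 3 ∷ 3 ∷ 0 ∷ 0 ∷ 0 ∷ 0 ∷ 0 ∷ 0 ∷ []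
potentialRow (just top)    (just none)   = 0 ∷ 3 ∷ 0 ∷ 6 ∷ 0 ∷ 2 ∷ 0 ∷ 2 ∷ 0 ∷ 0 ∷ 0 ∷ 6 ∷ 0 ∷ 9 ∷ 0 ∷ 5 ∷ 0 ∷ 5 ∷ 0 ∷ 1 ∷ 0 ∷ 4 ∷ 0 ∷ 7 ∷ 0 ∷ 3 ∷ 0 ∷ 3 ∷ 0 ∷ 0 ∷ 2 ∷ 5 ∷ 5 ∷ 8 ∷ 1 ∷ 4 ∷ 1 ∷ 4 ∷ 0 ∷ 0 ∷ 0 ∷ 2 ∷ 3 ∷ 5 ∷ 0 ∷ 1 ∷ 0 ∷ 1 ∷ 0 ∷ 0 ∷ []
potentialRow (just top)    (just top)    = 1 ∷ 3 ∷ 4 ∷ 6 ∷ 0 ∷ 2 ∷ 0 ∷ 2 ∷ 0 ∷ 0 ∷ 4 ∷ 6 ∷ 7 ∷ 9 ∷ 3 ∷ 5 ∷ 3 ∷ 5 ∷ 0 ∷ 1 ∷ 0 ∷ 2 ∷ 3 ∷ 5 ∷ 0 ∷ 1 ∷ 0 ∷ 1 ∷ 0 ∷ 0 ∷ 0 ∷ 2 ∷ 3 ∷ 5 ∷ 0 ∷ 1 ∷ 0 ∷ 1 ∷ 0 ∷ 0 ∷ 0 ∷ 0 ∷ 3 ∷ 3 ∷ 0 ∷ 0 ∷ 0 ∷ 0 ∷ 0 ∷ 0 ∷ []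
potentialRow (just top)    (just bottom) = 0 ∷ 3 ∷ 3 ∷ 6 ∷ 0 ∷ 2 ∷ 0 ∷ 2 ∷ 0 ∷ 0 ∷ 3 ∷ 6 ∷ 6 ∷ 9 ∷ 2 ∷ 5 ∷ 2 ∷ 5 ∷ 0 ∷ 1 ∷ 0 ∷ 3 ∷ 3 ∷ 6 ∷ 0 ∷ 2 ∷ 0 ∷ 2 ∷ 0 ∷ 0 ∷ 0 ∷ 2 ∷ 3 ∷ 5 ∷ 0 ∷ 1 ∷ 0 ∷ 1 ∷ 0 ∷ 0 ∷ 0 ∷ 0 ∷ 3 ∷ 3 ∷ 0 ∷ 0 ∷ 0 ∷ 0 ∷ 0 ∷ 0 ∷ []
potentialRow (just top)    (just both)   = 0 ∷ 0 ∷ 3 ∷ 3 ∷ 0 ∷ 0 ∷ 0 ∷ 0 ∷ 0 ∷ 0 ∷ 3 ∷ 3 ∷ 6 ∷ 6 ∷ 2 ∷ 2 ∷ 2 ∷ 2 ∷ 0 ∷ 0 ∷ 0 ∷ 0 ∷ 3 ∷ 3 ∷ 0 ∷ 0 ∷ 0 ∷ 0 ∷ 0 ∷ 0 ∷ 0 ∷ 0 ∷ 3 ∷ 3 ∷ 0 ∷ 0 ∷ 0 ∷ 0 ∷ 0 ∷ 0 ∷ 0 ∷ 0 ∷ 3 ∷ 3 ∷ 0 ∷ 0 ∷ 0 ∷ 0 ∷ 0 ∷ 0 ∷ []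
potentialRow (just bottom) nothing       = 2 ∷ 4 ∷ 5 ∷ 7 ∷ 1 ∷ 3 ∷ 1 ∷ 3 ∷ 0 ∷ 0 ∷ 5 ∷ 7 ∷ 8 ∷ 10 ∷ 4 ∷ 6 ∷ 4 ∷ 6 ∷ 0 ∷ 2 ∷ 1 ∷ 3 ∷ 4 ∷ 6 ∷ 0 ∷ 2 ∷ 0 ∷ 2 ∷ 0 ∷ 0 ∷ 1 ∷ 3 ∷ 4 ∷ 6 ∷ 0 ∷ 2 ∷ 0 ∷ 2 ∷ 0 ∷ 0 ∷ 0 ∷ 0 ∷ 3 ∷ 3 ∷ 0 ∷ 0 ∷ 0 ∷ 0 ∷ 0 ∷ 0 ∷ []
potentialRow (just bottom) (just none)   = 0 ∷ 3 ∷ 0 ∷ 6 ∷ 0 ∷ 2 ∷ 0 ∷ 2 ∷ 0 ∷ 0 ∷ 0 ∷ 6 ∷ 0 ∷ 9 ∷ 0 ∷ 5 ∷ 0 ∷ 5 ∷ 0 ∷ 1 ∷ 2 ∷ 5 ∷ 5 ∷ 8 ∷ 1 ∷ 4 ∷ 1 ∷ 4 ∷ 0 ∷ 0 ∷ 0 ∷ 4 ∷ 0 ∷ 7 ∷ 0 ∷ 3 ∷ 0 ∷ 3 ∷ 0 ∷ 0 ∷ 0 ∷ 2 ∷ 3 ∷ 5 ∷ 0 ∷ 1 ∷ 0 ∷ 1 ∷ 0 ∷ 0 ∷ []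
potentialRow (just bottom) (just top)    = 0 ∷ 3 ∷ 3 ∷ 6 ∷ 0 ∷ 2 ∷ 0 ∷ 2 ∷ 0 ∷ 0 ∷ 3 ∷ 6 ∷ 6 ∷ 9 ∷ 2 ∷ 5 ∷ 2 ∷ 5 ∷ 0 ∷ 1 ∷ 0 ∷ 2 ∷ 3 ∷ 5 ∷ 0 ∷ 1 ∷ 0 ∷ 1 ∷ 0 ∷ 0 ∷ 0 ∷ 3 ∷ 3 ∷ 6 ∷ 0 ∷ 2 ∷ 0 ∷ 2 ∷ 0 ∷ 0 ∷ 0 ∷ 0 ∷ 3 ∷ 3 ∷ 0 ∷ 0 ∷ 0 ∷ 0 ∷ 0 ∷ 0 ∷ []
potentialRow (just bottom) (just bottom) = 1 ∷ 3 ∷ 4 ∷ 6 ∷ 0 ∷ 2 ∷ 0 ∷ 2 ∷ 0 ∷ 0 ∷ 4 ∷ 6 ∷ 7 ∷ 9 ∷ 3 ∷ 5 ∷ 3 ∷ 5 ∷ 0 ∷ 1 ∷ 0 ∷ 2 ∷ 3 ∷ 5 ∷ 0 ∷ 1 ∷ 0 ∷ 1 ∷ 0 ∷ 0 ∷ 0 ∷ 2 ∷ 3 ∷ 5 ∷ 0 ∷ 1 ∷ 0 ∷ 1 ∷ 0 ∷ 0 ∷ 0 ∷ 0 ∷ 3 ∷ 3 ∷ 0 ∷ 0 ∷ 0 ∷ 0 ∷ 0 ∷ 0 ∷ []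
potentialRow (just bottom) (just both)   = 0 ∷ 0 ∷ 3 ∷ 3 ∷ 0 ∷ 0 ∷ 0 ∷ 0 ∷ 0 ∷ 0 ∷ 3 ∷ 3 ∷ 6 ∷ 6 ∷ 2 ∷ 2 ∷ 2 ∷ 2 ∷ 0 ∷ 0 ∷ 0 ∷ 0 ∷ 3 ∷ 3 ∷ 0 ∷ 0 ∷ 0 ∷ 0 ∷ 0 ∷ 0 ∷ 0 ∷ 0 ∷ 3 ∷ 3 ∷ 0 ∷ 0 ∷ 0 ∷ 0 ∷ 0 ∷ 0 ∷ 0 ∷ 0 ∷ 3 ∷ 3 ∷ 0 ∷ 0 ∷ 0 ∷ 0 ∷ 0 ∷ 0 ∷ []
potentialRow (just both)   nothing       = 1 ∷ 2 ∷ 4 ∷ 5 ∷ 0 ∷ 1 ∷ 0 ∷ 1 ∷ 0 ∷ 0 ∷ 4 ∷ 5 ∷ 7 ∷ 8 ∷ 3 ∷ 4 ∷ 3 ∷ 4 ∷ 0 ∷ 0 ∷ 0 ∷ 1 ∷ 3 ∷ 4 ∷ 0 ∷ 0 ∷ 0 ∷ 0 ∷ 0 ∷ 0 ∷ 0 ∷ 1 ∷ 3 ∷ 4 ∷ 0 ∷ 0 ∷ 0 ∷ 0 ∷ 0 ∷ 0 ∷ 0 ∷ 0 ∷ 3 ∷ 3 ∷ 0 ∷ 0 ∷ 0 ∷ 0 ∷ 0 ∷ 0 ∷ []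
potentialRow (just both)   (just none)   = 3 ∷ 3 ∷ 6 ∷ 6 ∷ 2 ∷ 2 ∷ 2 ∷ 2 ∷ 0 ∷ 0 ∷ 6 ∷ 6 ∷ 9 ∷ 9 ∷ 5 ∷ 5 ∷ 5 ∷ 5 ∷ 1 ∷ 1 ∷ 2 ∷ 4 ∷ 5 ∷ 7 ∷ 1 ∷ 3 ∷ 1 ∷ 3 ∷ 0 ∷ 0 ∷ 2 ∷ 4 ∷ 5 ∷ 7 ∷ 1 ∷ 3 ∷ 1 ∷ 3 ∷ 0 ∷ 0 ∷ 0 ∷ 0 ∷ 3 ∷ 3 ∷ 0 ∷ 0 ∷ 0 ∷ 0 ∷ 0 ∷ 0 ∷ []
potentialRow (just both)   (just top)    = 0 ∷ 1 ∷ 3 ∷ 4 ∷ 0 ∷ 0 ∷ 0 ∷ 0 ∷ 0 ∷ 0 ∷ 3 ∷ 4 ∷ 6 ∷ 7 ∷ 2 ∷ 3 ∷ 2 ∷ 3 ∷ 0 ∷ 0 ∷ 0 ∷ 0 ∷ 3 ∷ 3 ∷ 0 ∷ 0 ∷ 0 ∷ 0 ∷ 0 ∷ 0 ∷ 0 ∷ 0 ∷ 3 ∷ 3 ∷ 0 ∷ 0 ∷ 0 ∷ 0 ∷ 0 ∷ 0 ∷ 0 ∷ 0 ∷ 3 ∷ 3 ∷ 0 ∷ 0 ∷ 0 ∷ 0 ∷ 0 ∷ 0 ∷ []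
potentialRow (just both)   (just bottom) = 0 ∷ 1 ∷ 3 ∷ 4 ∷ 0 ∷ 0 ∷ 0 ∷ 0 ∷ 0 ∷ 0 ∷ 3 ∷ 4 ∷ 6 ∷ 7 ∷ 2 ∷ 3 ∷ 2 ∷ 3 ∷ 0 ∷ 0 ∷ 0 ∷ 0 ∷ 3 ∷ 3 ∷ 0 ∷ 0 ∷ 0 ∷ 0 ∷ 0 ∷ 0 ∷ 0 ∷ 0 ∷ 3 ∷ 3 ∷ 0 ∷ 0 ∷ 0 ∷ 0 ∷ 0 ∷ 0 ∷ 0 ∷ 0 ∷ 3 ∷ 3 ∷ 0 ∷ 0 ∷ 0 ∷ 0 ∷ 0 ∷ 0 ∷ []
potentialRow (just both)   (just both)   = 0 ∷ 0 ∷ 3 ∷ 3 ∷ 0 ∷ 0 ∷ 0 ∷ 0 ∷ 0 ∷ 0 ∷ 3 ∷ 3 ∷ 6 ∷ 6 ∷ 2 ∷ 2 ∷ 2 ∷ 2 ∷ 0 ∷ 0 ∷ 0 ∷ 0 ∷ 3 ∷ 3 ∷ 0 ∷ 0 ∷ 0 ∷ 0 ∷ 0 ∷ 0 ∷ 0 ∷ 0 ∷ 3 ∷ 3 ∷ 0 ∷ 0 ∷ 0 ∷ 0 ∷ 0 ∷ 0 ∷ 0 ∷ 0 ∷ 3 ∷ 3 ∷ 0 ∷ 0 ∷ 0 ∷ 0 ∷ 0 ∷ 0 ∷ []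

potential : State → ℕ
potential (c₀ , c₁ , c₂ , c₃ , e) = at (potentialRow c₀ c₁) (10 * cellIndex c₂ + 2 * cellIndex c₃ + flagIndex e)
  where
  at : List ℕ → ℕ → ℕ
  at []       _       = 0
  at (v ∷ vs) zero    = v
  at (v ∷ vs) (suc i) = at vs i

allCells : List (Maybe Column)
allCells = nothing ∷ just none ∷ just top ∷ just bottom ∷ just both ∷ []

∈-allCells : ∀ c → c ∈ allCells
∈-allCells nothing       = here refl
∈-allCells (just none)   = there (here refl)
∈-allCells (just top)    = there (there (here refl))
∈-allCells (just bottom) = there (there (there (here refl)))
∈-allCells (just both)   = there (there (there (there (here refl))))

allStates : List State
allStates = cartesianProduct allCells (cartesianProduct allCells (cartesianProduct allCells
              (cartesianProduct allCells (false ∷ true ∷ []))))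

∈-allStates : ∀ s → s ∈ allStates
∈-allStates (c₀ , c₁ , c₂ , c₃ , e) =
  ∈-cartesianProduct⁺ (∈-allCells c₀) (∈-cartesianProduct⁺ (∈-allCells c₁) (∈-cartesianProduct⁺ (∈-allCells c₂)
    (∈-cartesianProduct⁺ (∈-allCells c₃) (∈-flag e))))
  where
  ∈-flag : ∀ e → e ∈ false ∷ true ∷ []
  ∈-flag false = here refl
  ∈-flag true  = there (here refl)

potentialStepᵇ : State → Maybe Column → Bool
potentialStepᵇ s c = not (validStep s c) ∨ (potential s + 3 * width c ≤ᵇ potential (step s c) + 4 * cellSize c)

potentialStepsᵇ : State → Bool
potentialStepsᵇ s = all (potentialStepᵇ s) allCells

potential-certificate : all potentialStepsᵇ allStates ≡ true
potential-certificate = refl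

potential-step : ∀ s c → T (validStep s c) → potential s + 3 * width c ≤ potential (step s c) + 4 * cellSize c
potential-step s c v
  with to T-∨ (All.lookup (all⁺ (potentialStepᵇ s) allCells
                 (All.lookup (all⁺ potentialStepsᵇ allStates (from T-≡ potential-certificate)) (∈-allStates s)))
               (∈-allCells c))
... | inj₁ ¬v = ⊥-elim (T-not⁻ ¬v v)
... | inj₂ le = ≤ᵇ⇒≤ _ _ le

telescope : ∀ a b c w W z Z → a + 3 * w ≤ b + 4 * z → b + 3 * W ≤ c + 4 * Z →
            a + 3 * (w + W) ≤ c + 4 * (z + Z)
telescope a b c w W z Z h₁ h₂ = begin
  a + 3 * (w + W)     ≡⟨ regroup a w W 3 ⟩
  (a + 3 * w) + 3 * W ≤⟨ +-monoˡ-≤ (3 * W) h₁ ⟩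
  (b + 4 * z) + 3 * W ≡⟨ swap b (4 * z) (3 * W) ⟩
  (b + 3 * W) + 4 * z ≤⟨ +-monoˡ-≤ (4 * z) h₂ ⟩
  (c + 4 * Z) + 4 * z ≡⟨ sym (trans (regroup c z Z 4) (swap c (4 * z) (4 * Z))) ⟩
  c + 4 * (z + Z)     ∎
  where
  open ≤-Reasoning
  regroup : ∀ a w W k → a + k * (w + W) ≡ (a + k * w) + k * W
  regroup = solve-∀
  swap : ∀ a b c → (a + b) + c ≡ (a + c) + b
  swap = solve-∀

potential-run : ∀ s l → WindowsValid (cellsFrom s l) (flagOf s) →
                potential s + 3 * sum (map width l) ≤ potential (run s l) + 4 * sum (map cellSize l)
potential-run s []      _ = ≤-refl
potential-run s (c ∷ l) h =
  telescope (potential s) (potential (step s c)) (potential (run (step s c) l))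
            (width c) (sum (map width l)) (cellSize c) (sum (map cellSize l))
    (potential-step s c (windowsValid-head s c l h))
    (potential-run (step s c) l (windowsValid-tail s c l h))

sizeSum : List Column → ℕ
sizeSum w = sum (map size w)

widthSum-padded : ∀ w → sum (map width (map just w ++ pads)) ≡ length w
widthSum-padded []      = refl
widthSum-padded (_ ∷ w) = cong suc (widthSum-padded w)

sizeSum-padded : ∀ w → sum (map cellSize (map just w ++ pads)) ≡ sizeSum w
sizeSum-padded []      = refl
sizeSum-padded (c ∷ w) = cong (size c +_) (sizeSum-padded w)

potential-final : ∀ e → potential (nothing , nothing , nothing , nothing , e) ≤ 4
potential-final false = n≤1+n 3
potential-final true  = ≤-refl

potential-run-pads : ∀ s l → potential (run s (l ++ pads)) ≤ 4
potential-run-pads s@(_ , _ , _ , _ , _) [] = potential-final (flagOf (run s pads))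
potential-run-pads s (c ∷ l) = potential-run-pads (step s c) l

windowsValid-size : ∀ w → WindowsValid (padded w) false → 3 * length w ≤ 4 * sizeSum w + 1
windowsValid-size w h = +-cancelˡ-≤ 3 _ _ (begin
  3 + 3 * length w
    ≡⟨ cong (λ m → 3 + 3 * m) (sym (widthSum-padded w)) ⟩
  potential initial + 3 * sum (map width cells)
    ≤⟨ potential-run initial cells h ⟩
  potential (run initial cells) + 4 * sum (map cellSize cells)
    ≤⟨ +-mono-≤ (potential-run-pads initial (map just w)) (≤-reflexive (cong (4 *_) (sizeSum-padded w))) ⟩
  4 + 4 * sizeSum w
    ≡⟨ cong (3 +_) (+-comm 1 (4 * sizeSum w)) ⟩
  3 + (4 * sizeSum w + 1) ∎)
  where
  open ≤-Reasoning
  cells : List (Maybe Column)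
  cells = map just w ++ pads

-- Vertex sets and the words describing them

-- Cell sequences start with four padding cells, so the vertex x sits at offset o of the window
-- starting at k when 4 + col x ≡ k + o.
d₁-window : ∀ {n} (z x : Vertex n) {k o ox} → 4 + col z ≡ k + o → 4 + col x ≡ k + ox →
            d₁ (Ladder n) z x ≡ ladderD₁ (row z) o (row x) ox
d₁-window {n} z x {k} {o} {ox} ez ex = begin
  d₁ (Ladder n) z x                                ≡⟨ ladder-d₁ z x ⟩
  ladderD₁ (row z) (col z) (row x) (col x)         ≡⟨ sym (ladderD₁-+ 4 (row z) (col z) (row x) (col x)) ⟩
  ladderD₁ (row z) (4 + col z) (row x) (4 + col x) ≡⟨ cong₂ (λ i j → ladderD₁ (row z) i (row x) j) ez ex ⟩
  ladderD₁ (row z) (k + o) (row x) (k + ox)        ≡⟨ ladderD₁-+ k (row z) o (row x) ox ⟩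
  ladderD₁ (row z) o (row x) ox                    ∎
  where open ≡-Reasoning

window-offset : ∀ {p k ox} → 1 ≤ ox → ox ≤ 3 → p ≤ suc (k + ox) → k + ox ≤ suc p →
                ∃ λ (o : Fin 5) → p ≡ k + toℕ o
window-offset {p} {k} {ox} 1≤ox ox≤3 p≤ q≤ =
  fromℕ< (s≤s p∸k≤4) , trans (sym (m+[n∸m]≡n k≤p)) (cong (k +_) (sym (toℕ-fromℕ< (s≤s p∸k≤4))))
  where
  k≤p : k ≤ p
  k≤p = ≤-pred (≤-trans (≤-reflexive (+-comm 1 k)) (≤-trans (+-monoʳ-≤ k 1≤ox) q≤))
  p∸k≤4 : p ∸ k ≤ 4
  p∸k≤4 = subst (p ∸ k ≤_) (m+n∸m≡n k 4)
            (∸-monoˡ-≤ k (≤-trans p≤ (≤-trans (s≤s (+-monoʳ-≤ k ox≤3)) (≤-reflexive (sym (+-suc k 3))))))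

near-in-window : ∀ {n} (z x : Vertex n) k {ox} → 1 ≤ ox → ox ≤ 3 → 4 + col x ≡ k + ox →
                 d₁ (Ladder n) z x ≢ 2 → ∃ λ (o : Fin 5) → 4 + col z ≡ k + toℕ o
near-in-window z x k {ox} 1≤ox ox≤3 ex d≢2 =
  let i≤ , j≤ = ladderD₁<2⇒near (row z) (4 + col z) (row x) (k + ox)
                  (subst (_< 2) (d₁-window z x {k = 0} refl ex) (≤∧≢⇒< (d₁≤2 z x) d≢2))
  in window-offset 1≤ox ox≤3 i≤ j≤

4+c≡2+c+2 : ∀ c → 4 + c ≡ 2 + c + 2
4+c≡2+c+2 c = cong (2 +_) (+-comm 2 c)

occupiedIn : List Column → ℕ → ℕ → Bool
occupiedIn w r j = occupies r (cellAt (map just w) j)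

Encodes : ∀ {n} → List (Vertex n) → List Column → Set
Encodes {n} A w = length w ≡ n × (∀ v → v ∈ A ⇔ T (occupiedIn w (row v) (col v)))

cellAt-pads : ∀ l j → cellAt (l ++ pads) j ≡ cellAt l j
cellAt-pads []      0                         = refl
cellAt-pads []      1                         = refl
cellAt-pads []      2                         = refl
cellAt-pads []      3                         = refl
cellAt-pads []      (suc (suc (suc (suc _)))) = refl
cellAt-pads (c ∷ l) zero                      = refl
cellAt-pads (c ∷ l) (suc j)                   = cellAt-pads l j

is-just-cellAt⁻ : ∀ w j → T (is-just (cellAt (map just w) j)) → j < length w
is-just-cellAt⁻ (c ∷ w) zero    _ = z<s
is-just-cellAt⁻ (c ∷ w) (suc j) h = s<s (is-just-cellAt⁻ w j h)

is-just-cellAt⁺ : ∀ w j → j < length w → T (is-just (cellAt (map just w) j))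
is-just-cellAt⁺ (c ∷ w) zero    _       = tt
is-just-cellAt⁺ (c ∷ w) (suc j) (s<s h) = is-just-cellAt⁺ w j h

occupies⇒is-just : ∀ r c → T (occupies r c) → T (is-just c)
occupies⇒is-just r (just _) _ = tt
occupies⇒is-just 0 nothing ()
occupies⇒is-just 1 nothing ()
occupies⇒is-just (suc (suc _)) nothing ()

occupies⇒row<2 : ∀ r c → T (occupies r c) → r < 2
occupies⇒row<2 0 _ _ = s≤s z≤n
occupies⇒row<2 1 _ _ = ≤-refl

module Encoding {n} {A : List (Vertex n)} {w : List Column} (enc : Encodes A w) where

  in-ladder⁻ : ∀ p → T (is-just (padded w p)) → ∃ λ (i : Fin n) → 4 + toℕ i ≡ p
  in-ladder⁻ (suc (suc (suc (suc j)))) h = fromℕ< j<n , cong (4 +_) (toℕ-fromℕ< j<n)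
    where
    j<n : j < n
    j<n = subst (j <_) (proj₁ enc) (is-just-cellAt⁻ w j (subst (T ∘ is-just) (cellAt-pads (map just w) j) h))

  in-ladder⁺ : ∀ (i : Fin n) → T (is-just (padded w (4 + toℕ i)))
  in-ladder⁺ i = subst (T ∘ is-just) (sym (cellAt-pads (map just w) (toℕ i)))
                   (is-just-cellAt⁺ w (toℕ i) (subst (toℕ i <_) (sym (proj₁ enc)) (toℕ<n i)))

  occupied⁺ : ∀ {z} → z ∈ A → T (occupies (row z) (padded w (4 + col z)))
  occupied⁺ {z} z∈A = subst (T ∘ occupies (row z)) (sym (cellAt-pads (map just w) (col z))) (to (proj₂ enc z) z∈A)

  occupied⁻ : ∀ r p → T (occupies r (padded w p)) → ∃ λ z → z ∈ A × row z ≡ r × 4 + col z ≡ p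
  occupied⁻ r p h with in-ladder⁻ p (occupies⇒is-just r _ h)
  ... | i , refl = (fromℕ< r<2 , i) , from (proj₂ enc _) occ , toℕ-fromℕ< r<2 , refl
    where
    r<2 : r < 2
    r<2 = occupies⇒row<2 r _ h
    occ : T (occupiedIn w (toℕ (fromℕ< r<2)) (toℕ i))
    occ rewrite toℕ-fromℕ< r<2 = subst (T ∘ occupies r) (cellAt-pads (map just w) (toℕ i)) h

Undominated : ∀ {n} → List (Vertex n) → Vertex n → Set
Undominated {n} A x = ∀ z → z ∈ A → d₁ (Ladder n) z x ≡ 2

module FromResolving {n} {A : List (Vertex n)} {w : List Column}
                     (enc : Encodes A w) (res : IsAdjResolving (Ladder n) A) where
  open Encoding {A = A} {w = w} enc

  g : Cells
  g = padded w

  undominated-unique : ∀ {x y} → Undominated A x → Undominated A y → x ≡ y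
  undominated-unique {x} {y} ux uy with Graph._≟_ (Ladder n) x y
  ... | yes x≡y = x≡y
  ... | no x≢y  = let z , z∈A , d≢ = res x y x≢y in ⊥-elim (d≢ (trans (ux z z∈A) (sym (uy z z∈A))))

  resolves-in-window : ∀ k (x y : Vertex n) {ox oy} → 1 ≤ ox → ox ≤ 3 → 1 ≤ oy → oy ≤ 3 →
                       4 + col x ≡ k + ox → 4 + col y ≡ k + oy → x ≢ y →
                       T (resolves (shift k g) (row x) ox (row y) oy)
  resolves-in-window k x y {ox} {oy} 1≤ox ox≤3 1≤oy oy≤3 ex ey x≢y with res x y x≢y
  ... | z , z∈A , d≢ =
    anyOccupied⁺ (shift k g) (λ r o′ → not (ladderD₁ r o′ (row x) ox ≡ᵇ ladderD₁ r o′ (row y) oy))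
      (toℕ<n (proj₁ z)) (toℕ<n o) occ (T-not⁺ (d≢ ∘ distances-≡ ∘ ≡ᵇ⇒≡ _ _))
    where
    located : ∃ λ (o : Fin 5) → 4 + col z ≡ k + toℕ o
    located with d₁ (Ladder n) z x ≟ 2
    ... | no dx≢2  = near-in-window z x k 1≤ox ox≤3 ex dx≢2
    ... | yes dx≡2 = near-in-window z y k 1≤oy oy≤3 ey (λ dy≡2 → d≢ (trans dx≡2 (sym dy≡2)))
    o : Fin 5
    o = proj₁ located
    occ : T (occupies (row z) (shift k g (toℕ o)))
    occ = subst (T ∘ occupies (row z) ∘ g) (proj₂ located) (occupied⁺ z∈A)
    distances-≡ : ladderD₁ (row z) (toℕ o) (row x) ox ≡ ladderD₁ (row z) (toℕ o) (row y) oy →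
                  d₁ (Ladder n) z x ≡ d₁ (Ladder n) z y
    distances-≡ e =
      trans (d₁-window z x {k} (proj₂ located) ex) (trans e (sym (d₁-window z y {k} (proj₂ located) ey)))

  close-pair-resolved : ∀ k t → ClosePair t → T (closePairResolved (shift k g) t)
  close-pair-resolved k (rx , ry , d) (rx<2 , ry<2 , d≤2 , apart) = T-→⁺ resolved
    where
    resolved : T (is-just (g (k + 1))) → T (is-just (g (k + (1 + d)))) → T (resolves (shift k g) rx 1 ry (1 + d))
    resolved px py with in-ladder⁻ _ px | in-ladder⁻ _ py
    ... | i , ei | j , ej =
        subst₂ (λ r s → T (resolves (shift k g) r 1 s (1 + d))) (toℕ-fromℕ< rx<2) (toℕ-fromℕ< ry<2)
          (resolves-in-window k x y ≤-refl (s≤s z≤n) (s≤s z≤n) (s≤s d≤2) ei ej x≢y)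
      where
      x y : Vertex n
      x = fromℕ< rx<2 , i
      y = fromℕ< ry<2 , j
      x≢y : x ≢ y
      x≢y x≡y = [ (λ rx≢ry → rx≢ry (trans (sym (toℕ-fromℕ< rx<2)) (trans (cong row x≡y) (toℕ-fromℕ< ry<2))))
                , (λ 0<d → <-irrefl (suc-injective (+-cancelˡ-≡ k 1 (1 + d)
                                       (trans (sym ei) (trans (cong (λ v → 4 + col v) x≡y) ej)))) 0<d)
                ]′ apart

  undominated-vertex : ∀ k (r : Fin 2) → T (undominated (shift k g) (toℕ r)) →
                       ∃ λ x → row x ≡ toℕ r × 4 + col x ≡ k + 2 × Undominated A x
  undominated-vertex k r h with to T-∧ h
  ... | present , ¬dominated with in-ladder⁻ (k + 2) present
  ...   | i , e = (r , i) , refl , e , undominated-ri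
    where
    undominated-ri : Undominated A (r , i)
    undominated-ri z z∈A with d₁ (Ladder n) z (r , i) ≟ 2
    ... | yes d≡2 = d≡2
    ... | no d≢2  = ⊥-elim (T-not⁻ ¬dominated
            (anyOccupied⁺ (shift k g) (λ r′ o′ → ladderD₁ r′ o′ (toℕ r) 2 <ᵇ 2)
              (toℕ<n (proj₁ z)) (toℕ<n o) occ (<⇒<ᵇ close)))
      where
      located : ∃ λ (o : Fin 5) → 4 + col z ≡ k + toℕ o
      located = near-in-window z (r , i) k (s≤s z≤n) (s≤s (s≤s z≤n)) e d≢2
      o : Fin 5
      o = proj₁ located
      occ : T (occupies (row z) (shift k g (toℕ o)))
      occ = subst (T ∘ occupies (row z) ∘ g) (proj₂ located) (occupied⁺ z∈A)
      close : ladderD₁ (row z) (toℕ o) (toℕ r) 2 < 2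
      close = subst (_< 2) (d₁-window z (r , i) {k} (proj₂ located) e) (≤∧≢⇒< (d₁≤2 z (r , i)) d≢2)

  some-undominated-vertex : ∀ k → T (someUndominated (shift k g)) → ∃ λ x → 4 + col x ≡ k + 2 × Undominated A x
  some-undominated-vertex k h with to (T-∨ {undominated (shift k g) 0}) h
  ... | inj₁ u₀ = let x , _ , e , ux = undominated-vertex k fzero u₀ in x , e , ux
  ... | inj₂ u₁ = let x , _ , e , ux = undominated-vertex k (fsuc fzero) u₁ in x , e , ux

  windows-valid : WindowsValid g false
  windows-valid k = valid⁺ (shift k g) (flag g false k) close-pairs not-both no-second-undominated
    where
    close-pairs : T (closePairsResolved (shift k g))
    close-pairs =
      all⁻ (closePairResolved (shift k g)) (All.map (λ {t} → close-pair-resolved k t) closePairs-close)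
    not-both : T (not (undominated (shift k g) 0 ∧ undominated (shift k g) 1))
    not-both = T-not-∧⁺ λ u₀ u₁ →
      let x , rx , _ , ux = undominated-vertex k fzero u₀
          y , ry , _ , uy = undominated-vertex k (fsuc fzero) u₁
      in 0≢1+n (trans (sym rx) (trans (cong row (undominated-unique ux uy)) ry))
    no-second-undominated : T (not (flag g false k ∧ someUndominated (shift k g)))
    no-second-undominated = T-not-∧⁺ λ fl u → case flag-source g false k fl of λ where
      (inj₁ ())
      (inj₂ (j , j<k , u′)) →
        let x , ex , ux = some-undominated-vertex k u
            y , ey , uy = some-undominated-vertex j u′
        in <-irrefl (+-cancelʳ-≡ 2 j k
                      (trans (sym ey) (trans (cong (λ v → 4 + col v) (undominated-unique uy ux)) ex))) j<k

data PairKind (r s : Fin 2) (d : ℕ) : Set where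
  identical     : r ≡ s → d ≡ 0 → PairKind r s d
  close         : (toℕ r , toℕ s , d) ∈ closePairs → PairKind r s d
  close-swapped : (toℕ s , toℕ r , d) ∈ closePairs → d ≡ 0 → PairKind r s d
  distant       : Far (toℕ r) (toℕ s) d → PairKind r s d

pairKind : ∀ r s d → PairKind r s d
pairKind fzero        fzero        0 = identical refl refl
pairKind fzero        (fsuc fzero) 0 = close (here refl)
pairKind (fsuc fzero) fzero        0 = close-swapped (here refl) refl
pairKind (fsuc fzero) (fsuc fzero) 0 = identical refl refl
pairKind fzero        fzero        1 = close (there (here refl))
pairKind (fsuc fzero) (fsuc fzero) 1 = close (there (there (here refl)))
pairKind fzero        (fsuc fzero) 1 = close (there (there (there (here refl))))
pairKind (fsuc fzero) fzero        1 = close (there (there (there (there (here refl)))))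
pairKind fzero        fzero        2 = close (there (there (there (there (there (here refl))))))
pairKind (fsuc fzero) (fsuc fzero) 2 = close (there (there (there (there (there (there (here refl)))))))
pairKind fzero        (fsuc fzero) 2 = distant (inj₂ (refl , λ ()))
pairKind (fsuc fzero) fzero        2 = distant (inj₂ (refl , λ ()))
pairKind r            s            (suc (suc (suc d))) = distant (inj₁ (s≤s (s≤s (s≤s z≤n))))

module FromWindows {n} {A : List (Vertex n)} {w : List Column}
                   (enc : Encodes A w) (valid-windows : WindowsValid (padded w) false) where
  open Encoding {A = A} {w = w} enc

  g : Cells
  g = padded w

  Resolved : Vertex n → Vertex n → Set
  Resolved x y = ∃ λ z → z ∈ A × d₁ (Ladder n) z x ≢ d₁ (Ladder n) z y

  resolved-sym : ∀ {x y} → Resolved x y → Resolved y x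
  resolved-sym (z , z∈A , d≢) = z , z∈A , d≢ ∘ sym

  resolved-in-window : ∀ k (x y : Vertex n) {ox oy} → 4 + col x ≡ k + ox → 4 + col y ≡ k + oy →
                       T (resolves (shift k g) (row x) ox (row y) oy) → Resolved x y
  resolved-in-window k x y {ox} {oy} ex ey h
    with anyOccupied⁻ (shift k g) (λ r o → not (ladderD₁ r o (row x) ox ≡ᵇ ladderD₁ r o (row y) oy)) h
  ... | r , o , occ , ≢ᵇ with occupied⁻ r (k + o) occ
  ...   | z , z∈A , rz≡r , ez = z , z∈A , λ d≡ → T-not⁻ ≢ᵇ (≡⇒≡ᵇ _ _
            (subst (λ ρ → ladderD₁ ρ o (row x) ox ≡ ladderD₁ ρ o (row y) oy) rz≡r
              (trans (sym (d₁-window z x {k} ez ex)) (trans d≡ (d₁-window z y {k} ez ey)))))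

  resolved-close : ∀ (x y : Vertex n) d → col y ≡ col x + d → (row x , row y , d) ∈ closePairs → Resolved x y
  resolved-close x y d e mem = resolved-in-window k x y ex ey
    (T-→⁻ (All.lookup (all⁺ (closePairResolved (shift k g)) closePairs close-pairs) mem)
          (subst (T ∘ is-just ∘ g) ex (in-ladder⁺ (proj₂ x)))
          (subst (T ∘ is-just ∘ g) ey (in-ladder⁺ (proj₂ y))))
    where
    k : ℕ
    k = 3 + col x
    ex : 4 + col x ≡ k + 1
    ex = cong (3 +_) (+-comm 1 (col x))
    ey : 4 + col y ≡ k + (1 + d)
    ey = trans (cong (4 +_) e) (cong (3 +_) (sym (+-suc (col x) d)))
    close-pairs : T (closePairsResolved (shift k g))
    close-pairs = proj₁ (valid⁻ (shift k g) (flag g false k) (valid-windows k))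

  no-second-undominated : ∀ k → T (flag g false k) → T (someUndominated (shift k g)) → ⊥
  no-second-undominated k fl u =
    T-not⁻ (proj₂ (proj₂ (valid⁻ (shift k g) (flag g false k) (valid-windows k)))) (from T-∧ (fl , u))

  dominator : ∀ (x : Vertex n) → T (dominated (shift (2 + col x) g) (row x) 2) →
              ∃ λ z → z ∈ A × d₁ (Ladder n) z x < 2
  dominator x h with anyOccupied⁻ (shift (2 + col x) g) (λ r o → ladderD₁ r o (row x) 2 <ᵇ 2) h
  ... | r , o , occ , near with occupied⁻ r (2 + col x + o) occ
  ...   | z , z∈A , rz≡r , ez = z , z∈A , subst (_< 2) d≡ (<ᵇ⇒< _ _ near)
    where
    d≡ : ladderD₁ r o (row x) 2 ≡ d₁ (Ladder n) z x
    d≡ = sym (trans (d₁-window z x {2 + col x} ez (4+c≡2+c+2 (col x)))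
                    (cong (λ ρ → ladderD₁ ρ o (row x) 2) rz≡r))

  undominated-centre : ∀ (x : Vertex n) → ¬ T (dominated (shift (2 + col x) g) (row x) 2) →
                       T (someUndominated (shift (2 + col x) g))
  undominated-centre (fzero , i)        ¬d = from T-∨ (inj₁ (from T-∧ (present , T-not⁺ ¬d)))
    where present = subst (T ∘ is-just ∘ g) (4+c≡2+c+2 (toℕ i)) (in-ladder⁺ i)
  undominated-centre (fsuc fzero , i) ¬d =
    from (T-∨ {undominated (shift (2 + toℕ i) g) 0}) (inj₂ (from T-∧ (present , T-not⁺ ¬d)))
    where present = subst (T ∘ is-just ∘ g) (4+c≡2+c+2 (toℕ i)) (in-ladder⁺ i)

  resolved-far : ∀ (x y : Vertex n) d → col y ≡ col x + d → Far (row x) (row y) d → Resolved x y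
  resolved-far x y d e farness with T? (dominated (shift (2 + col x) g) (row x) 2)
  ... | yes dx = let z , z∈A , zx<2 = dominator x dx
                 in z , z∈A , λ d≡ → far-no-common-dominator x y z e farness zx<2 (subst (_< 2) d≡ zx<2)
  ... | no ¬dx with T? (dominated (shift (2 + col y) g) (row y) 2)
  ...   | yes dy = let z , z∈A , zy<2 = dominator y dy
                   in z , z∈A , λ d≡ → far-no-common-dominator x y z e farness (subst (_< 2) (sym d≡) zy<2) zy<2
  ...   | no ¬dy = ⊥-elim (no-second-undominated (2 + col y) (flag-set g false x-before-y (undominated-centre x ¬dx))
                                                   (undominated-centre y ¬dy))
    where
    x-before-y : 2 + col x < 2 + col y
    x-before-y =
      +-monoʳ-< 2 (subst (col x <_) (sym e) (m<m+n (col x) (≤-trans (s≤s z≤n) (Far⇒2≤gap farness))))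

  resolved-ordered : ∀ (x y : Vertex n) d → col y ≡ col x + d → x ≢ y → Resolved x y
  resolved-ordered x y d e x≢y with pairKind (proj₁ x) (proj₁ y) d
  ... | identical refl refl = ⊥-elim (x≢y (cong (proj₁ x ,_) (toℕ-injective (sym (trans e (+-identityʳ _))))))
  ... | close mem = resolved-close x y d e mem
  ... | close-swapped mem refl =
    resolved-sym (resolved-close y x 0 (trans (sym (trans e (+-identityʳ _))) (sym (+-identityʳ _))) mem)
  ... | distant farness = resolved-far x y d e farness

  resolving : IsAdjResolving (Ladder n) A
  resolving x y x≢y with ≤-total (col x) (col y)
  ... | inj₁ x≤y = resolved-ordered x y _ (sym (m+[n∸m]≡n x≤y)) x≢y
  ... | inj₂ y≤x = resolved-sym (resolved-ordered y x _ (sym (m+[n∸m]≡n y≤x)) (x≢y ∘ sym))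

markRow : Fin 2 → Column → Column
markRow fzero        (_ , b) = true , b
markRow (fsuc fzero) (t , _) = t , true

markAt : Fin 2 → ℕ → List Column → List Column
markAt r j       []      = []
markAt r zero    (c ∷ w) = markRow r c ∷ w
markAt r (suc j) (c ∷ w) = c ∷ markAt r j w

columnWord : ∀ {n} → List (Vertex n) → List Column
columnWord {n} []      = replicate n none
columnWord     (z ∷ A) = markAt (proj₁ z) (col z) (columnWord A)

length-markAt : ∀ r j w → length (markAt r j w) ≡ length w
length-markAt r j       []      = refl
length-markAt r zero    (c ∷ w) = refl
length-markAt r (suc j) (c ∷ w) = cong suc (length-markAt r j w)

length-columnWord : ∀ {n} (A : List (Vertex n)) → length (columnWord A) ≡ n
length-columnWord {n} []      = length-replicate n
length-columnWord     (z ∷ A) = trans (length-markAt (proj₁ z) (col z) (columnWord A)) (length-columnWord A)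

occupiedIn-none : ∀ n (r : Fin 2) j → occupiedIn (replicate n none) (toℕ r) j ≡ false
occupiedIn-none zero    fzero        j       = refl
occupiedIn-none zero    (fsuc fzero) j       = refl
occupiedIn-none (suc n) fzero        zero    = refl
occupiedIn-none (suc n) (fsuc fzero) zero    = refl
occupiedIn-none (suc n) r            (suc j) = occupiedIn-none n r j

occupiedIn-markAt : ∀ r j w (r′ : Fin 2) j′ → j < length w →
  occupiedIn (markAt r j w) (toℕ r′) j′ ≡ ((toℕ r′ ≡ᵇ toℕ r) ∧ (j′ ≡ᵇ j)) ∨ occupiedIn w (toℕ r′) j′
occupiedIn-markAt fzero        zero (c ∷ w) fzero        zero _ = refl
occupiedIn-markAt fzero        zero (c ∷ w) (fsuc fzero) zero _ = refl
occupiedIn-markAt (fsuc fzero) zero (c ∷ w) fzero        zero _ = refl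
occupiedIn-markAt (fsuc fzero) zero (c ∷ w) (fsuc fzero) zero _ = refl
occupiedIn-markAt r zero    (c ∷ w) r′ (suc j′) _ rewrite ∧-zeroʳ (toℕ r′ ≡ᵇ toℕ r) = refl
occupiedIn-markAt r (suc j) (c ∷ w) r′ zero     _ rewrite ∧-zeroʳ (toℕ r′ ≡ᵇ toℕ r) = refl
occupiedIn-markAt r (suc j) (c ∷ w) r′ (suc j′) (s<s j<∣w∣) = occupiedIn-markAt r j w r′ j′ j<∣w∣

columnWord-encodes : ∀ {n} (A : List (Vertex n)) → Encodes A (columnWord A)
columnWord-encodes A = length-columnWord A , λ v → mk⇔ (∈⇒occupied A v) (occupied⇒∈ A v)
  where
  marked : ∀ {n} (z : Vertex n) (A : List (Vertex n)) (v : Vertex n) →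
           occupiedIn (columnWord (z ∷ A)) (row v) (col v) ≡
           ((row v ≡ᵇ row z) ∧ (col v ≡ᵇ col z)) ∨ occupiedIn (columnWord A) (row v) (col v)
  marked z A v = occupiedIn-markAt (proj₁ z) (col z) (columnWord A) (proj₁ v) (col v)
                   (subst (col z <_) (sym (length-columnWord A)) (toℕ<n (proj₂ z)))
  ∈⇒occupied : ∀ {n} (A : List (Vertex n)) v → v ∈ A → T (occupiedIn (columnWord A) (row v) (col v))
  ∈⇒occupied (z ∷ A) v (here refl) rewrite marked z A v =
    from T-∨ (inj₁ (from T-∧ (≡⇒≡ᵇ (row v) (row v) refl , ≡⇒≡ᵇ (col v) (col v) refl)))
  ∈⇒occupied (z ∷ A) v (there v∈A) rewrite marked z A v =
    from (T-∨ {(row v ≡ᵇ row z) ∧ (col v ≡ᵇ col z)}) (inj₂ (∈⇒occupied A v v∈A))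
  occupied⇒∈ : ∀ {n} (A : List (Vertex n)) v → T (occupiedIn (columnWord A) (row v) (col v)) → v ∈ A
  occupied⇒∈ {n} [] v h rewrite occupiedIn-none n (proj₁ v) (col v) = ⊥-elim h
  occupied⇒∈ (z ∷ A) v h rewrite marked z A v with to (T-∨ {(row v ≡ᵇ row z) ∧ (col v ≡ᵇ col z)}) h
  ... | inj₂ occ = there (occupied⇒∈ A v occ)
  ... | inj₁ v≈z with to (T-∧ {row v ≡ᵇ row z}) v≈z
  ...   | r≡ , c≡ = here (cong₂ _,_ (toℕ-injective (≡ᵇ⇒≡ _ _ r≡)) (toℕ-injective (≡ᵇ⇒≡ _ _ c≡)))

sizeSum-none : ∀ n → sizeSum (replicate n none) ≡ 0
sizeSum-none zero    = refl
sizeSum-none (suc n) = sizeSum-none n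

size-markRow : ∀ r c → size (markRow r c) ≤ suc (size c)
size-markRow fzero        none   = ≤-refl
size-markRow fzero        top    = n≤1+n 1
size-markRow fzero        bottom = ≤-refl
size-markRow fzero        both   = n≤1+n 2
size-markRow (fsuc fzero) none   = ≤-refl
size-markRow (fsuc fzero) top    = ≤-refl
size-markRow (fsuc fzero) bottom = n≤1+n 1
size-markRow (fsuc fzero) both   = n≤1+n 2

sizeSum-markAt : ∀ r j w → sizeSum (markAt r j w) ≤ suc (sizeSum w)
sizeSum-markAt r j       []      = z≤n
sizeSum-markAt r zero    (c ∷ w) = +-monoˡ-≤ (sizeSum w) (size-markRow r c)
sizeSum-markAt r (suc j) (c ∷ w) =
  ≤-trans (+-monoʳ-≤ (size c) (sizeSum-markAt r j w)) (≤-reflexive (+-suc (size c) (sizeSum w)))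

sizeSum-columnWord : ∀ {n} (A : List (Vertex n)) → sizeSum (columnWord A) ≤ length A
sizeSum-columnWord {n} []      = ≤-reflexive (sizeSum-none n)
sizeSum-columnWord     (z ∷ A) =
  ≤-trans (sizeSum-markAt (proj₁ z) (col z) (columnWord A)) (s≤s (sizeSum-columnWord A))

columnVertices : ∀ {n} → Column → Fin n → List (Vertex n)
columnVertices none   i = []
columnVertices top    i = (fzero , i) ∷ []
columnVertices bottom i = (fsuc fzero , i) ∷ []
columnVertices both   i = (fzero , i) ∷ (fsuc fzero , i) ∷ []

∈-columnVertices⁻ : ∀ {n} c {i} {v : Vertex n} → v ∈ columnVertices c i → proj₂ v ≡ i × T (occupies (row v) (just c))
∈-columnVertices⁻ top    (here refl)         = refl , tt
∈-columnVertices⁻ bottom (here refl)         = refl , tt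
∈-columnVertices⁻ both   (here refl)         = refl , tt
∈-columnVertices⁻ both   (there (here refl)) = refl , tt

∈-columnVertices⁺ : ∀ {n} c r (i : Fin n) → T (occupies (toℕ r) (just c)) → (r , i) ∈ columnVertices c i
∈-columnVertices⁺ none   fzero        i ()
∈-columnVertices⁺ none   (fsuc fzero) i ()
∈-columnVertices⁺ top    fzero        i _ = here refl
∈-columnVertices⁺ top    (fsuc fzero) i ()
∈-columnVertices⁺ bottom fzero        i ()
∈-columnVertices⁺ bottom (fsuc fzero) i _ = here refl
∈-columnVertices⁺ both   fzero        i _ = here refl
∈-columnVertices⁺ both   (fsuc fzero) i _ = there (here refl)

length-columnVertices : ∀ {n} c (i : Fin n) → length (columnVertices c i) ≡ size c
length-columnVertices none   i = refl
length-columnVertices top    i = refl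
length-columnVertices bottom i = refl
length-columnVertices both   i = refl

verticesOf : (w : List Column) → List (Vertex (length w))
verticesOf []      = []
verticesOf (c ∷ w) = columnVertices c fzero ++ map (map₂ fsuc) (verticesOf w)

length-verticesOf : ∀ w → length (verticesOf w) ≡ sizeSum w
length-verticesOf []      = refl
length-verticesOf (c ∷ w) = begin
  length (columnVertices c fzero ++ map (map₂ fsuc) (verticesOf w))
    ≡⟨ length-++ (columnVertices c fzero) ⟩
  length (columnVertices c fzero) + length (map (map₂ fsuc) (verticesOf w))
    ≡⟨ cong₂ _+_ (length-columnVertices c fzero) (length-map (map₂ fsuc) (verticesOf w)) ⟩
  size c + length (verticesOf w)
    ≡⟨ cong (size c +_) (length-verticesOf w) ⟩
  size c + sizeSum w ∎
  where open ≡-Reasoning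

verticesOf-encodes : ∀ w → Encodes (verticesOf w) w
verticesOf-encodes w = refl , λ v → mk⇔ (∈⇒occupied w v) (occupied⇒∈ w v)
  where
  ∈⇒occupied : ∀ w v → v ∈ verticesOf w → T (occupiedIn w (row v) (col v))
  ∈⇒occupied (c ∷ w) v v∈ with ∈-++⁻ (columnVertices c fzero) v∈
  ... | inj₁ v∈c with ∈-columnVertices⁻ c v∈c
  ...   | refl , occ = occ
  ∈⇒occupied (c ∷ w) v v∈ | inj₂ v∈w with ∈-map⁻ (map₂ fsuc) v∈w
  ...   | u , u∈ , refl = ∈⇒occupied w u u∈
  occupied⇒∈ : ∀ w v → T (occupiedIn w (row v) (col v)) → v ∈ verticesOf w
  occupied⇒∈ (c ∷ w) (r , fzero)  occ = ∈-++⁺ˡ (∈-columnVertices⁺ c r fzero occ)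
  occupied⇒∈ (c ∷ w) (r , fsuc i) occ =
    ∈-++⁺ʳ (columnVertices c fzero) (∈-map⁺ (map₂ fsuc) (occupied⇒∈ w (r , i) occ))

encoded-vertices : ∀ w {n} → length w ≡ n → ∃ λ (A : List (Vertex n)) → Encodes A w × length A ≡ sizeSum w
encoded-vertices w refl = verticesOf w , verticesOf-encodes w , length-verticesOf w

-- Optimal words

-- Found by a search over periodic words: the block brings the automaton back to `periodicState`.
block : List Column
block = none ∷ both ∷ none ∷ top ∷ none ∷ both ∷ none ∷ bottom ∷ []

blocks : ℕ → List Column
blocks zero    = []
blocks (suc m) = block ++ blocks m

ending : ℕ → List Column
ending 0 = []
ending 1 = bottom ∷ []
ending 2 = none ∷ bottom ∷ []
ending 3 = none ∷ bottom ∷ bottom ∷ []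
ending 4 = none ∷ bottom ∷ none ∷ both ∷ []
ending 5 = none ∷ bottom ∷ none ∷ both ∷ top ∷ []
ending 6 = none ∷ bottom ∷ none ∷ both ∷ none ∷ top ∷ []
ending _ = none ∷ bottom ∷ none ∷ both ∷ none ∷ top ∷ top ∷ []

word : ℕ → ℕ → List Column
word m t = bottom ∷ blocks m ++ ending t

afterBottom : State
afterBottom = step initial (just bottom)

periodicState : State
periodicState = run afterBottom (map just block)

periodicState-periodic : run periodicState (map just block) ≡ periodicState
periodicState-periodic = refl

map-just-++ : ∀ xs ys (zs : List (Maybe Column)) → map just (xs ++ ys) ++ zs ≡ map just xs ++ (map just ys ++ zs)
map-just-++ xs ys zs = trans (cong (_++ zs) (map-++ just xs ys)) (++-assoc (map just xs) (map just ys) zs)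

accepts-blocks : ∀ m l → T (accepts periodicState l) → T (accepts periodicState (map just (blocks m) ++ l))
accepts-blocks zero    l h = h
accepts-blocks (suc m) l h = subst (T ∘ accepts periodicState) (sym (map-just-++ block (blocks m) l))
  (accepts-++ periodicState (map just block) (map just (blocks m) ++ l) tt
    (subst (λ s → T (accepts s (map just (blocks m) ++ l))) (sym periodicState-periodic) (accepts-blocks m l h)))

endings-accepted : ∀ {t} → t < 8 →
  T (accepts afterBottom (map just (ending t) ++ pads)) × T (accepts periodicState (map just (ending t) ++ pads))
endings-accepted {0} _ = tt , tt
endings-accepted {1} _ = tt , tt
endings-accepted {2} _ = tt , tt
endings-accepted {3} _ = tt , tt
endings-accepted {4} _ = tt , tt
endings-accepted {5} _ = tt , tt
endings-accepted {6} _ = tt , tt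
endings-accepted {7} _ = tt , tt
endings-accepted {suc (suc (suc (suc (suc (suc (suc (suc _)))))))} (s≤s (s≤s (s≤s (s≤s (s≤s (s≤s (s≤s (s≤s ()))))))))

word-accepted : ∀ m {t} → t < 8 → T (accepts initial (map just (word m t) ++ pads))
word-accepted zero    t<8 = from T-∧ (tt , proj₁ (endings-accepted t<8))
word-accepted (suc m) {t} t<8 = from T-∧ (tt , subst (T ∘ accepts afterBottom) (sym cells≡)
  (accepts-++ afterBottom (map just block) (map just (blocks m) ++ (map just (ending t) ++ pads)) tt
    (accepts-blocks m _ (proj₂ (endings-accepted t<8)))))
  where
  cells≡ : map just ((block ++ blocks m) ++ ending t) ++ pads ≡
           map just block ++ (map just (blocks m) ++ (map just (ending t) ++ pads))
  cells≡ = trans (map-just-++ (block ++ blocks m) (ending t) pads)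
                 (map-just-++ block (blocks m) (map just (ending t) ++ pads))

sizeSum-++ : ∀ xs ys → sizeSum (xs ++ ys) ≡ sizeSum xs + sizeSum ys
sizeSum-++ xs ys = trans (cong sum (map-++ size xs ys)) (sum-++ (map size xs) (map size ys))

length-blocks : ∀ m → length (blocks m) ≡ m * 8
length-blocks zero    = refl
length-blocks (suc m) = cong (8 +_) (length-blocks m)

sizeSum-blocks : ∀ m → sizeSum (blocks m) ≡ m * 6
sizeSum-blocks zero    = refl
sizeSum-blocks (suc m) = trans (sizeSum-++ block (blocks m)) (cong (6 +_) (sizeSum-blocks m))

ending-size : ∀ {t} → t < 8 → length (ending t) ≡ t × 4 * sizeSum (ending t) ≤ 3 * t + 1
ending-size {0} _ = refl , z≤n
ending-size {1} _ = refl , ≤-refl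
ending-size {2} _ = refl , ≤ᵇ⇒≤ 4 7 tt
ending-size {3} _ = refl , ≤ᵇ⇒≤ 8 10 tt
ending-size {4} _ = refl , ≤ᵇ⇒≤ 12 13 tt
ending-size {5} _ = refl , ≤-refl
ending-size {6} _ = refl , ≤ᵇ⇒≤ 16 19 tt
ending-size {7} _ = refl , ≤ᵇ⇒≤ 20 22 tt
ending-size {suc (suc (suc (suc (suc (suc (suc (suc _)))))))} (s≤s (s≤s (s≤s (s≤s (s≤s (s≤s (s≤s (s≤s ()))))))))

length-word : ∀ m {t} → t < 8 → length (word m t) ≡ suc (t + m * 8)
length-word m {t} t<8 = cong suc (begin
  length (blocks m ++ ending t)          ≡⟨ length-++ (blocks m) ⟩
  length (blocks m) + length (ending t)  ≡⟨ cong₂ _+_ (length-blocks m) (proj₁ (ending-size t<8)) ⟩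
  m * 8 + t                              ≡⟨ +-comm (m * 8) t ⟩
  t + m * 8                              ∎)
  where open ≡-Reasoning

sizeSum-word : ∀ m {t} → t < 8 → 4 * sizeSum (word m t) ≤ 3 * length (word m t) + 2
sizeSum-word m {t} t<8 = begin
  4 * sizeSum (word m t)                     ≡⟨ cong (λ k → 4 * suc k) sizeSum-tail ⟩
  4 * suc (m * 6 + sizeSum (ending t))       ≡⟨ expand m (sizeSum (ending t)) ⟩
  4 + m * 24 + 4 * sizeSum (ending t)        ≤⟨ +-monoʳ-≤ (4 + m * 24) (proj₂ (ending-size t<8)) ⟩
  4 + m * 24 + (3 * t + 1)                   ≡⟨ regroup m t ⟩
  3 * suc (t + m * 8) + 2                    ≡⟨ cong (λ k → 3 * k + 2) (sym (length-word m t<8)) ⟩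
  3 * length (word m t) + 2                  ∎
  where
  open ≤-Reasoning
  expand : ∀ m s → 4 * suc (m * 6 + s) ≡ 4 + m * 24 + 4 * s
  expand = solve-∀
  regroup : ∀ m t → 4 + m * 24 + (3 * t + 1) ≡ 3 * suc (t + m * 8) + 2
  regroup = solve-∀
  sizeSum-tail : sizeSum (blocks m ++ ending t) ≡ m * 6 + sizeSum (ending t)
  sizeSum-tail = trans (sizeSum-++ (blocks m) (ending t)) (cong (_+ sizeSum (ending t)) (sizeSum-blocks m))

-- The adjacency dimension of the ladder

adim-lower : ∀ {n} (A : List (Vertex n)) → IsAdjResolving (Ladder n) A → 3 * n ≤ 4 * length A + 1
adim-lower {n} A res = begin
  3 * n                           ≡⟨ cong (3 *_) (sym (length-columnWord A)) ⟩
  3 * length (columnWord A)       ≤⟨ windowsValid-size (columnWord A) (FromResolving.windows-valid enc res) ⟩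
  4 * sizeSum (columnWord A) + 1  ≤⟨ +-monoˡ-≤ 1 (*-monoʳ-≤ 4 (sizeSum-columnWord A)) ⟩
  4 * length A + 1                ∎
  where
  open ≤-Reasoning
  enc : Encodes A (columnWord A)
  enc = columnWord-encodes A

adim-upper : ∀ n → ∃ λ (A : List (Vertex n)) → IsAdjResolving (Ladder n) A × 4 * length A ≤ 3 * n + 2
adim-upper zero    = [] , (λ { (_ , ()) }) , z≤n
adim-upper (suc n) =
  let A , enc , |A|≡ = encoded-vertices w length-w
  in A , FromWindows.resolving enc (accepts-sound initial (map just w ++ pads) (word-accepted (n / 8) t<8)) ,
     subst₂ (λ a b → 4 * a ≤ 3 * b + 2) (sym |A|≡) length-w (sizeSum-word (n / 8) t<8)
  where
  t<8 : n % 8 < 8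
  t<8 = m%n<n n 8
  w : List Column
  w = word (n / 8) (n % 8)
  length-w : length w ≡ suc n
  length-w = trans (length-word (n / 8) t<8) (cong suc (sym (m≡m%n+[m/n]*n n 8)))

3n∸1+3≡3n+2 : ∀ {n} → 1 ≤ n → 3 * n ∸ 1 + 3 ≡ 3 * n + 2
3n∸1+3≡3n+2 {n} 1≤n = pred+3 (≤-trans 1≤n (m≤n*m n 3))
  where
  pred+3 : ∀ {m} → 1 ≤ m → m ∸ 1 + 3 ≡ m + 2
  pred+3 {suc m} _ = +-suc m 2

≤-⌈3n∸1/4⌉ : ∀ {n k} → 1 ≤ n → 4 * k ≤ 3 * n + 2 → k ≤ ⌈ 3 * n ∸ 1 / 4 ⌉
≤-⌈3n∸1/4⌉ {n} {k} 1≤n 4k≤ = subst₂ _≤_ (m*n/n≡m k 4) (cong (_/ 4) (sym (3n∸1+3≡3n+2 1≤n)))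
                           (/-monoˡ-≤ 4 (subst (_≤ 3 * n + 2) (*-comm 4 k) 4k≤))

⌈3n∸1/4⌉-≤ : ∀ {n k} → 1 ≤ n → 3 * n ≤ 4 * k + 1 → ⌈ 3 * n ∸ 1 / 4 ⌉ ≤ k
⌈3n∸1/4⌉-≤ {n} {k} 1≤n 3n≤ = ≤-pred (m<n*o⇒m/o<n (begin-strict
  3 * n ∸ 1 + 3      ≡⟨ 3n∸1+3≡3n+2 1≤n ⟩
  3 * n + 2          ≤⟨ +-monoˡ-≤ 2 3n≤ ⟩
  4 * k + 1 + 2      ≡⟨ +-assoc (4 * k) 1 2 ⟩
  4 * k + 3          <⟨ n<1+n _ ⟩
  suc (4 * k + 3)    ≡⟨ regroup k ⟩
  suc k * 4          ∎))
  where
  open ≤-Reasoning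
  regroup : ∀ k → suc (4 * k + 3) ≡ suc k * 4
  regroup = solve-∀

adim-ladder : ∀ n → 1 ≤ n → IsAdim (Ladder n) ⌈ 3 * n ∸ 1 / 4 ⌉
adim-ladder n 1≤n =
  let A , res , small = adim-upper n
  in isAdim (Ladder n) _ A res (≤-⌈3n∸1/4⌉ 1≤n small) (λ B resB → ⌈3n∸1/4⌉-≤ 1≤n (adim-lower B resB))

theorem1p11 : (n : ℕ) → n ≥ 2 →
    Σ ℕ λ a → IsAdim (P 2 □ P n) a ×
      (⌈ 3 * n ∸ 1 / 4 ⌉ ∸ 1 ≤ a × a ≤ ⌈ 3 * n ∸ 1 / 4 ⌉)
theorem1p11 n n≥2 = ⌈ 3 * n ∸ 1 / 4 ⌉ , adim-ladder n (≤-trans (s≤s z≤n) n≥2) , m∸n≤m _ 1 , ≤-refl
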